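{- For every positive integer $n$, $|\mathcal{J}_n|=|\mathcal{K}_n|=(n-2)2^{n-1}+2$.
   Context: Geometric grid classes: for a matrix $M$ with entries in $\{0,1,-1\}$, divide a rectangle into unit cells indexed by the entries of $M$ (row $i$ from the top, column $j$ from the left); in each cell with entry $1$ draw the segment joining its lower-left and upper-right corners, with entry $-1$ the segment joining its upper-left and lower-right corners. $\mathcal{G}_n(M)$ is the set of $\pi\in\mathfrak{S}_n$ obtained by placing $n$ points on these segments with no two sharing an $x$- or $y$-coordinate, labeling them $1,\dots,n$ by increasing $y$-coordinate and reading the labels by increasing $x$-coordinate. $\mathcal{J}_n=\mathcal{G}_n(M_J)$ where $M_J$ has rows (top to bottom) $(0,1),(1,0),(1,0),(0,1)$, and $\mathcal{K}_n=\mathcal{G}_n(M_K)$ where $M_K$ has rows (top to bottom) $(1,0),(0,1),(-1,0),(0,-1)$.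
   Formalization: The n points placed on the segments of the cells have rational coordinates. -}

module Defs where

open import Data.Nat using (ℕ; suc; _∸_)
open import Data.Fin using (Fin; toℕ; zero; suc)
import Data.Fin as F
open import Data.Integer using (+_)
open import Data.Rational using (ℚ; _/_; _+_; _-_; _<_; _≤_; 0ℚ; 1ℚ)
open import Data.Vec using (Vec; lookup)
open import Data.List using (List; length)
open import Data.List.Membership.Propositional using (_∈_)
open import Data.List.Relation.Unary.Unique.Propositional using (Unique)
open import Data.Product using (Σ; _×_)
open import Function.Bundles using (_⇔_)
open import Function.Definitions using (Injective)
open import Relation.Binary.PropositionalEquality using (_≡_; _≢_)

data Entry : Set where
  o  : Entry
  p1 : Entry
  m1 : Entry

-- An r×c matrix, rows indexed from the top, columns from the left.
Matrix : ℕ → ℕ → Set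
Matrix r c = Fin r → Fin c → Entry

ℕtoℚ : ℕ → ℚ
ℕtoℚ k = + k / 1

-- A point placed on the segment of a nonzero cell (i , j) of M.
-- Cell (i , j) is the unit square [j , j+1] × [r-1-i , r-i].
-- The parameter t ∈ [0,1] is the x-offset inside the cell.
record Point {r c : ℕ} (M : Matrix r c) : Set where
  constructor pt
  field
    row     : Fin r
    col     : Fin c
    nonzero : M row col ≢ o
    t       : ℚ
    t≥0     : 0ℚ ≤ t
    t≤1     : t ≤ 1ℚ

module _ {r c : ℕ} {M : Matrix r c} where
  xcoord : Point M → ℚ
  xcoord P = ℕtoℚ (toℕ (Point.col P)) + Point.t P

  -- entry 1: segment from lower-left to upper-right corner (y rises with t);
  -- entry -1: segment from upper-left to lower-right corner (y falls with t).
  yOffset : Entry → ℚ → ℚ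
  yOffset o  s = 0ℚ
  yOffset p1 s = s
  yOffset m1 s = 1ℚ - s

  ycoord : Point M → ℚ
  ycoord P = ℕtoℚ (r ∸ suc (toℕ (Point.row P)))
             + yOffset (M (Point.row P) (Point.col P)) (Point.t P)

-- Permutations of [n] in one-line notation π(1)…π(n) (values in Fin n).
IsPerm : {n : ℕ} → Vec (Fin n) n → Set
IsPerm {n} π = Injective _≡_ _≡_ (lookup π)

-- π ∈ G_n(M): there are n points on the segments of M, indexed 0..n-1 in order of
-- strictly increasing x-coordinate (so no two share an x-coordinate), whose
-- y-coordinates are ordered exactly as the values of π (so no two share a
-- y-coordinate and the label of the i-th point from the left, by increasing y, is π(i)).
InGrid : {r c n : ℕ} → Matrix r c → Vec (Fin n) n → Set
InGrid {n = n} M π =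
  IsPerm π ×
  Σ (Fin n → Point M) λ P →
    ((i j : Fin n) → i F.< j → xcoord (P i) < xcoord (P j)) ×
    ((i j : Fin n) → lookup π i F.< lookup π j → ycoord (P i) < ycoord (P j))

HasCard : {n : ℕ} → (Vec (Fin n) n → Set) → ℕ → Set
HasCard {n} Q k =
  Σ (List (Vec (Fin n) n)) λ L →
    Unique L × length L ≡ k × ((π : Vec (Fin n) n) → (Q π ⇔ π ∈ L))

MJ : Matrix 4 2
MJ zero                   zero       = o
MJ zero                   (suc zero) = p1
MJ (suc zero)             zero       = p1
MJ (suc zero)             (suc zero) = o
MJ (suc (suc zero))       zero       = p1
MJ (suc (suc zero))       (suc zero) = o
MJ (suc (suc (suc zero))) zero       = o
MJ (suc (suc (suc zero))) (suc zero) = p1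

MK : Matrix 4 2
MK zero                   zero       = p1
MK zero                   (suc zero) = o
MK (suc zero)             zero       = o
MK (suc zero)             (suc zero) = p1
MK (suc (suc zero))       zero       = m1
MK (suc (suc zero))       (suc zero) = o
MK (suc (suc (suc zero))) zero       = o
MK (suc (suc (suc zero))) (suc zero) = m1

module Submission where

-- Every row of M_J and of M_K has exactly one nonzero cell, so a gridded permutation is determined by the
-- word of rows of its points read from left to right: points are ordered by height band by band, and within
-- a band by position along the segment of the cell. A word arises from a gridding exactly when its columns
-- never decrease, and conversely such a word is realised by evenly spaced points. Two words give the same
-- permutation exactly when they have the same inversions, and an automaton reading two words in parallel,
-- remembering which pairs of rows it has met, decides this. Exploring its reachable states certifies, by
-- evaluation, that an explicit automaton accepts exactly one word of each class of column-monotone words.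
-- Its accepted words are counted by linear recurrences, giving (n - 2) 2^(n-1) + 2 for both matrices.

open import Defs

module Counting where

  open import Data.Empty using (⊥-elim)
  open import Data.Fin using (Fin; zero; suc; toℕ; fromℕ<)
  import Data.Fin.Properties as Finₚ
  open import Data.Nat using (ℕ; zero; suc; _+_; _∸_; _≤_; _<_; z≤n; s≤s)
  import Data.Nat.Properties as ℕₚ
  open import Data.Sum using (_⊎_)
  open import Data.Unit using (tt)
  open import Function using (_∘′_)
  open import Function.Definitions using (Injective)
  open import Relation.Binary.Definitions using (tri<; tri≈; tri>)
  open import Relation.Binary.PropositionalEquality
  open import Relation.Nullary using (¬_; Dec; yes; no)
  open import Relation.Nullary.Decidable using (_⊎-dec_)
  open import Relation.Unary using (Pred; Decidable)

  shift : ∀ {n p} {P : Pred (Fin (suc n)) p} → Decidable P → Decidable (λ i → P (suc i))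
  shift P? i = P? (suc i)

  count : ∀ {n p} {P : Pred (Fin n) p} → Decidable P → ℕ
  count {zero}  P? = 0
  count {suc n} P? with P? zero
  ... | yes _ = suc (count (shift P?))
  ... | no  _ = count (shift P?)

  count-mono : ∀ {n p q} {P : Pred (Fin n) p} {Q : Pred (Fin n) q} (P? : Decidable P) (Q? : Decidable Q) →
               (∀ i → P i → Q i) → count P? ≤ count Q?
  count-mono {zero}  P? Q? P⇒Q = z≤n
  count-mono {suc n} P? Q? P⇒Q with P? zero | Q? zero
  ... | yes _  | yes _  = s≤s (count-mono (shift P?) (shift Q?) (λ i → P⇒Q (suc i)))
  ... | no  _  | yes _  = ℕₚ.m≤n⇒m≤1+n (count-mono (shift P?) (shift Q?) (λ i → P⇒Q (suc i)))
  ... | no  _  | no  _  = count-mono (shift P?) (shift Q?) (λ i → P⇒Q (suc i))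
  ... | yes p₀ | no ¬q₀ = ⊥-elim (¬q₀ (P⇒Q zero p₀))

  count-strict : ∀ {n p q} {P : Pred (Fin n) p} {Q : Pred (Fin n) q} (P? : Decidable P) (Q? : Decidable Q) →
                 (∀ i → P i → Q i) → ∀ k → Q k → ¬ P k → count P? < count Q?
  count-strict {suc n} P? Q? P⇒Q zero qₖ ¬pₖ with P? zero | Q? zero
  ... | yes p₀ | _      = ⊥-elim (¬pₖ p₀)
  ... | no  _  | yes _  = s≤s (count-mono (shift P?) (shift Q?) (λ i → P⇒Q (suc i)))
  ... | no  _  | no ¬q₀ = ⊥-elim (¬q₀ qₖ)
  count-strict {suc n} P? Q? P⇒Q (suc k) qₖ ¬pₖ with P? zero | Q? zero
  ... | yes _  | yes _  = s≤s (count-strict (shift P?) (shift Q?) (λ i → P⇒Q (suc i)) k qₖ ¬pₖ)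
  ... | no  _  | yes _  = ℕₚ.m≤n⇒m≤1+n (count-strict (shift P?) (shift Q?) (λ i → P⇒Q (suc i)) k qₖ ¬pₖ)
  ... | no  _  | no  _  = count-strict (shift P?) (shift Q?) (λ i → P⇒Q (suc i)) k qₖ ¬pₖ
  ... | yes p₀ | no ¬q₀ = ⊥-elim (¬q₀ (P⇒Q zero p₀))

  count-cong : ∀ {n p q} {P : Pred (Fin n) p} {Q : Pred (Fin n) q} (P? : Decidable P) (Q? : Decidable Q) →
               (∀ i → P i → Q i) → (∀ i → Q i → P i) → count P? ≡ count Q?
  count-cong P? Q? P⇒Q Q⇒P = ℕₚ.≤-antisym (count-mono P? Q? P⇒Q) (count-mono Q? P? Q⇒P)

  count-⊎ : ∀ {n p q} {P : Pred (Fin n) p} {Q : Pred (Fin n) q} (P? : Decidable P) (Q? : Decidable Q) →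
            count (λ i → P? i ⊎-dec Q? i) ≤ count P? + count Q?
  count-⊎ {zero}  P? Q? = z≤n
  count-⊎ {suc n} P? Q? with P? zero | Q? zero
  ... | yes _ | yes _ =
    s≤s (ℕₚ.≤-trans (count-⊎ (shift P?) (shift Q?)) (ℕₚ.+-monoʳ-≤ (count (shift P?)) (ℕₚ.n≤1+n _)))
  ... | yes _ | no  _ = s≤s (count-⊎ (shift P?) (shift Q?))
  ... | no  _ | yes _ = ℕₚ.≤-trans (s≤s (count-⊎ (shift P?) (shift Q?))) (ℕₚ.≤-reflexive (sym (ℕₚ.+-suc _ _)))
  ... | no  _ | no  _ = count-⊎ (shift P?) (shift Q?)

  count-all : ∀ {n p} {P : Pred (Fin n) p} (P? : Decidable P) → (∀ i → P i) → count P? ≡ n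
  count-all {zero}  P? all-P = refl
  count-all {suc n} P? all-P with P? zero
  ... | yes _  = cong suc (count-all (shift P?) (λ i → all-P (suc i)))
  ... | no ¬p₀ = ⊥-elim (¬p₀ (all-P zero))

  count-none : ∀ {n p} {P : Pred (Fin n) p} (P? : Decidable P) → (∀ i → ¬ P i) → count P? ≡ 0
  count-none {zero}  P? no-P = refl
  count-none {suc n} P? no-P with P? zero
  ... | yes p₀ = ⊥-elim (no-P zero p₀)
  ... | no _   = count-none (shift P?) (λ i → no-P (suc i))

  count-atMostOne : ∀ {n p} {P : Pred (Fin n) p} (P? : Decidable P) →
                    (∀ i j → P i → P j → i ≡ j) → count P? ≤ 1
  count-atMostOne {zero}  P? unique = z≤n
  count-atMostOne {suc n} P? unique with P? zero
  ... | yes p₀ =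
    s≤s (ℕₚ.≤-reflexive (count-none (shift P?) λ i pᵢ → Finₚ.0≢1+n (unique zero (suc i) p₀ pᵢ)))
  ... | no _   = count-atMostOne (shift P?) (λ i j pᵢ pⱼ → Finₚ.suc-injective (unique (suc i) (suc j) pᵢ pⱼ))

  -- The preimage of [0, v) grows by at most one when v does, and is everything for v = n.
  module _ {n} (π : Fin n → Fin n) (π-injective : Injective _≡_ _≡_ π) where

    private
      below? : ∀ v k → Dec (toℕ (π k) < v)
      below? v k = toℕ (π k) ℕₚ.<? v

      hits? : ∀ v k → Dec (toℕ (π k) ≡ v)
      hits? v k = toℕ (π k) ℕₚ.≟ v

      below : ℕ → ℕ
      below v = count (below? v)

      below-suc : ∀ v → below (suc v) ≤ below v + 1
      below-suc v = begin
        below (suc v)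
          ≤⟨ count-mono (below? (suc v)) (λ k → below? v k ⊎-dec hits? v k) split ⟩
        count (λ k → below? v k ⊎-dec hits? v k)
          ≤⟨ count-⊎ (below? v) (hits? v) ⟩
        below v + count (hits? v)
          ≤⟨ ℕₚ.+-monoʳ-≤ (below v) (count-atMostOne (hits? v) hitOnce) ⟩
        below v + 1
          ∎
        where
        open ℕₚ.≤-Reasoning
        split : ∀ k → toℕ (π k) < suc v → toℕ (π k) < v ⊎ toℕ (π k) ≡ v
        split k lt = ℕₚ.m≤n⇒m<n∨m≡n (ℕₚ.≤-pred lt)
        hitOnce : ∀ i j → toℕ (π i) ≡ v → toℕ (π j) ≡ v → i ≡ j
        hitOnce i j eᵢ eⱼ = π-injective (Finₚ.toℕ-injective (trans eᵢ (sym eⱼ)))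

      below-+ : ∀ v m → below (v + m) ≤ below v + m
      below-+ v zero    = ℕₚ.≤-reflexive (trans (cong below (ℕₚ.+-identityʳ v)) (sym (ℕₚ.+-identityʳ _)))
      below-+ v (suc m) = begin
        below (v + suc m)   ≡⟨ cong below (ℕₚ.+-suc v m) ⟩
        below (suc (v + m)) ≤⟨ below-suc (v + m) ⟩
        below (v + m) + 1   ≤⟨ ℕₚ.+-monoˡ-≤ 1 (below-+ v m) ⟩
        below v + m + 1     ≡⟨ trans (ℕₚ.+-assoc (below v) m 1) (cong (below v +_) (ℕₚ.+-comm m 1)) ⟩
        below v + suc m     ∎
        where open ℕₚ.≤-Reasoning

      below≡ : ∀ v → v ≤ n → below v ≡ v
      below≡ v v≤n = ℕₚ.≤-antisym below≤ ≤below
        where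
        open ℕₚ.≤-Reasoning
        below≤ : below v ≤ v
        below≤ = begin
          below (0 + v) ≤⟨ below-+ 0 v ⟩
          below 0 + v   ≡⟨ cong (_+ v) (count-none (below? 0) (λ k ())) ⟩
          v             ∎
        ≤below : v ≤ below v
        ≤below = ℕₚ.+-cancelʳ-≤ (n ∸ v) v (below v) (begin
          v + (n ∸ v)         ≡⟨ ℕₚ.m+[n∸m]≡n v≤n ⟩
          n                   ≡⟨ count-all (below? n) (λ k → Finₚ.toℕ<n (π k)) ⟨
          below n             ≡⟨ cong below (ℕₚ.m+[n∸m]≡n v≤n) ⟨
          below (v + (n ∸ v)) ≤⟨ below-+ v (n ∸ v) ⟩
          below v + (n ∸ v)   ∎)

    count-below-injective : ∀ i → count (λ k → toℕ (π k) ℕₚ.<? toℕ (π i)) ≡ toℕ (π i)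
    count-below-injective i = below≡ (toℕ (π i)) (ℕₚ.<⇒≤ (Finₚ.toℕ<n (π i)))


  module Ranking {n} (key : Fin n → ℕ) where

    rankℕ : Fin n → ℕ
    rankℕ i = count (λ k → key k ℕₚ.<? key i)

    rankℕ<n : ∀ i → rankℕ i < n
    rankℕ<n i = subst (rankℕ i <_) (count-all (λ _ → yes tt) (λ _ → tt))
      (count-strict (λ k → key k ℕₚ.<? key i) (λ _ → yes tt) (λ _ _ → tt) i tt (ℕₚ.<-irrefl refl))

    rank : Fin n → Fin n
    rank i = fromℕ< (rankℕ<n i)

    toℕ-rank : ∀ i → toℕ (rank i) ≡ rankℕ i
    toℕ-rank i = Finₚ.toℕ-fromℕ< (rankℕ<n i)

    rank-mono : ∀ {i j} → key i < key j → toℕ (rank i) < toℕ (rank j)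
    rank-mono {i} {j} lt = subst₂ _<_ (sym (toℕ-rank i)) (sym (toℕ-rank j))
      (count-strict (λ k → key k ℕₚ.<? key i) (λ k → key k ℕₚ.<? key j)
        (λ k kᵢ → ℕₚ.<-trans kᵢ lt) i lt (ℕₚ.<-irrefl refl))

    module _ (key-injective : Injective _≡_ _≡_ key) where

      monotone⇒reflecting : (f : Fin n → Fin n) → (∀ {i j} → key i < key j → toℕ (f i) < toℕ (f j)) →
                            ∀ {i j} → toℕ (f i) < toℕ (f j) → key i < key j
      monotone⇒reflecting f f-mono {i} {j} lt with ℕₚ.<-cmp (key i) (key j)
      ... | tri< kᵢ<kⱼ _ _ = kᵢ<kⱼ
      ... | tri≈ _ kᵢ≡kⱼ _ = ⊥-elim (ℕₚ.<-irrefl (cong (toℕ ∘′ f) (key-injective kᵢ≡kⱼ)) lt)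
      ... | tri> _ _ kⱼ<kᵢ = ⊥-elim (ℕₚ.<-asym lt (f-mono kⱼ<kᵢ))

      rank-reflects : ∀ {i j} → toℕ (rank i) < toℕ (rank j) → key i < key j
      rank-reflects = monotone⇒reflecting rank rank-mono

      rank-injective : Injective _≡_ _≡_ rank
      rank-injective {i} {j} rᵢ≡rⱼ with ℕₚ.<-cmp (key i) (key j)
      ... | tri< kᵢ<kⱼ _ _ = ⊥-elim (ℕₚ.<-irrefl (cong toℕ rᵢ≡rⱼ) (rank-mono kᵢ<kⱼ))
      ... | tri≈ _ kᵢ≡kⱼ _ = key-injective kᵢ≡kⱼ
      ... | tri> _ _ kⱼ<kᵢ = ⊥-elim (ℕₚ.<-irrefl (cong toℕ (sym rᵢ≡rⱼ)) (rank-mono kⱼ<kᵢ))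

      -- π i and rank i both count the k below i.
      rank-unique : (π : Fin n → Fin n) → Injective _≡_ _≡_ π →
                    (∀ {i j} → key i < key j → toℕ (π i) < toℕ (π j)) → ∀ i → π i ≡ rank i
      rank-unique π π-injective π-mono i = Finₚ.toℕ-injective (begin
        toℕ (π i)
          ≡⟨ count-below-injective π π-injective i ⟨
        count (λ k → toℕ (π k) ℕₚ.<? toℕ (π i))
          ≡⟨ count-cong (λ k → toℕ (π k) ℕₚ.<? toℕ (π i)) (λ k → key k ℕₚ.<? key i)
                        (λ k → monotone⇒reflecting π π-mono) (λ k → π-mono) ⟩
        rankℕ i
          ≡⟨ toℕ-rank i ⟨
        toℕ (rank i)
          ∎)
        where open ≡-Reasoning

module Words where

  open Counting
  open import Data.Bool using (Bool; true; false; T; if_then_else_; _∧_; _∨_)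
  import Data.Bool.Properties as Boolₚ
  open import Data.Empty using (⊥-elim)
  open import Data.Fin as Fin using (Fin; toℕ)
  import Data.Fin.Properties as Finₚ
  open import Data.Nat using (ℕ; suc; _+_; _*_; _∸_; _≤_; _<_; _<ᵇ_; _≡ᵇ_)
  import Data.Nat.Properties as ℕₚ
  open import Data.Product using (_×_; _,_)
  open import Data.Sum using (_⊎_; inj₁; inj₂)
  open import Data.Unit using (tt)
  open import Data.Vec using (Vec; lookup)
  open import Function using (_∘_)
  open import Function.Bundles using (Equivalence)
  open import Function.Definitions using (Injective)
  open import Relation.Binary.Definitions using (tri<; tri≈; tri>)
  open import Relation.Binary.PropositionalEquality
  open import Relation.Nullary using (¬_)

  Row : Set
  Row = Fin 4

  -- Row x, counted from the top, is the horizontal band between heights band x and band x + 1.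
  band : Row → ℕ
  band x = 3 ∸ toℕ x

  band-anti : ∀ {x y : Row} → toℕ x < toℕ y → band y < band x
  band-anti {x} {y} x<y = ℕₚ.∸-monoʳ-< x<y (ℕₚ.≤-pred (Finₚ.toℕ<n y))

  band-injective : ∀ {x y : Row} → band x ≡ band y → x ≡ y
  band-injective {x} {y} eq =
    Finₚ.toℕ-injective (ℕₚ.∸-cancelˡ-≡ (ℕₚ.≤-pred (Finₚ.toℕ<n x)) (ℕₚ.≤-pred (Finₚ.toℕ<n y)) eq)

  ¬T⇒false : ∀ {b} → ¬ T b → b ≡ false
  ¬T⇒false ¬b = Boolₚ.¬-not (¬b ∘ Equivalence.from Boolₚ.T-≡)

  T-extensional : ∀ {a b} → (T a → T b) → (T b → T a) → a ≡ b
  T-extensional {true}  {true}  _ _ = refl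
  T-extensional {true}  {false} a⇒b _ = ⊥-elim (a⇒b tt)
  T-extensional {false} {true}  _ b⇒a = ⊥-elim (b⇒a tt)
  T-extensional {false} {false} _ _ = refl

  module Inversions (decreasing : Row → Bool) where

    -- For an earlier point on row x and a later point on row y: is the earlier one higher?
    inverts : Row → Row → Bool
    inverts x y = (toℕ x <ᵇ toℕ y) ∨ ((toℕ x ≡ᵇ toℕ y) ∧ decreasing x)

    inverts-< : ∀ {x y} → toℕ x < toℕ y → T (inverts x y)
    inverts-< {x} {y} x<y rewrite Boolₚ.T-≡ .Equivalence.to (ℕₚ.<⇒<ᵇ x<y) = tt

    inverts-> : ∀ {x y} → toℕ y < toℕ x → ¬ T (inverts x y)
    inverts-> {x} {y} y<x rewrite ¬T⇒false (ℕₚ.<⇒≯ y<x ∘ ℕₚ.<ᵇ⇒< (toℕ x) (toℕ y))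
                                | ¬T⇒false (ℕₚ.<⇒≢ y<x ∘ sym ∘ ℕₚ.≡ᵇ⇒≡ (toℕ x) (toℕ y)) = λ ()

    inverts-refl : ∀ x → inverts x x ≡ decreasing x
    inverts-refl x rewrite ¬T⇒false (ℕₚ.<-irrefl refl ∘ ℕₚ.<ᵇ⇒< (toℕ x) (toℕ x))
                         | Boolₚ.T-≡ .Equivalence.to (ℕₚ.≡⇒≡ᵇ (toℕ x) (toℕ x) refl) = refl

    offset : ∀ {n} → Row → Fin n → ℕ
    offset {n} x i = if decreasing x then n ∸ toℕ i else toℕ i

    offset≤n : ∀ {n} x (i : Fin n) → offset x i ≤ n
    offset≤n {n} x i with decreasing x
    ... | true  = ℕₚ.m∸n≤m n (toℕ i)
    ... | false = ℕₚ.<⇒≤ (Finₚ.toℕ<n i)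

    -- The height order of the points: by band, then by position in the band, which is reversed in a decreasing cell.
    key : ∀ {n} → Vec Row n → Fin n → ℕ
    key {n} w i = band (lookup w i) * suc n + offset (lookup w i) i

    perm : ∀ {n} → Vec Row n → Fin n → Fin n
    perm w = Ranking.rank (key w)

    lexicographic : ∀ {n b₁ b₂ o₁} o₂ → b₁ < b₂ → o₁ ≤ n → b₁ * suc n + o₁ < b₂ * suc n + o₂
    lexicographic {n} {b₁} {b₂} {o₁} o₂ b₁<b₂ o₁≤n = begin-strict
      b₁ * suc n + o₁    ≤⟨ ℕₚ.+-monoʳ-≤ (b₁ * suc n) o₁≤n ⟩
      b₁ * suc n + n     <⟨ ℕₚ.+-monoʳ-< (b₁ * suc n) (ℕₚ.n<1+n n) ⟩
      b₁ * suc n + suc n ≡⟨ ℕₚ.+-comm (b₁ * suc n) (suc n) ⟩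
      suc b₁ * suc n     ≤⟨ ℕₚ.*-monoˡ-≤ (suc n) b₁<b₂ ⟩
      b₂ * suc n         ≤⟨ ℕₚ.m≤m+n (b₂ * suc n) o₂ ⟩
      b₂ * suc n + o₂    ∎
      where open ℕₚ.≤-Reasoning

    key-split : ∀ {n} (w : Vec Row n) {a b} → key w a < key w b →
                band (lookup w a) < band (lookup w b) ⊎
                lookup w a ≡ lookup w b × offset (lookup w a) a < offset (lookup w b) b
    key-split {n} w {a} {b} lt with ℕₚ.<-cmp (band (lookup w a)) (band (lookup w b))
    ... | tri< bₐ<b_b _ _ = inj₁ bₐ<b_b
    ... | tri≈ _ bₐ≡b_b _ = inj₂ (band-injective bₐ≡b_b ,
            ℕₚ.+-cancelˡ-< (band (lookup w a) * suc n) _ _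
              (subst (λ β → key w a < β * suc n + offset (lookup w b) b) (sym bₐ≡b_b) lt))
    ... | tri> _ _ b_b<bₐ =
      ⊥-elim (ℕₚ.<-asym lt (lexicographic (offset (lookup w a) a) b_b<bₐ (offset≤n (lookup w b) b)))

    key-order : ∀ {n} (w : Vec Row n) {i j} → toℕ i < toℕ j →
                T (inverts (lookup w i) (lookup w j)) × key w j < key w i ⊎
                ¬ T (inverts (lookup w i) (lookup w j)) × key w i < key w j
    key-order {n} w {i} {j} i<j with lookup w i | lookup w j
    ... | x | y with Finₚ.<-cmp x y
    ... | tri< x<y _ _ = inj₁ (inverts-< x<y , lexicographic (offset x i) (band-anti x<y) (offset≤n y j))
    ... | tri> _ _ y<x = inj₂ (inverts-> y<x , lexicographic (offset y j) (band-anti y<x) (offset≤n x i))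
    ... | tri≈ _ refl _ rewrite inverts-refl x with decreasing x
    ... | true  = inj₁ (tt , ℕₚ.+-monoʳ-< (band x * suc n) (ℕₚ.∸-monoʳ-< i<j (ℕₚ.<⇒≤ (Finₚ.toℕ<n j))))
    ... | false = inj₂ ((λ ()) , ℕₚ.+-monoʳ-< (band x * suc n) i<j)

    inverts⇒key : ∀ {n} (w : Vec Row n) {i j} → toℕ i < toℕ j →
                  T (inverts (lookup w i) (lookup w j)) → key w j < key w i
    inverts⇒key w i<j inv with key-order w i<j
    ... | inj₁ (_ , lt)    = lt
    ... | inj₂ (¬inv , _)  = ⊥-elim (¬inv inv)

    key⇒inverts : ∀ {n} (w : Vec Row n) {i j} → toℕ i < toℕ j →
                  key w j < key w i → T (inverts (lookup w i) (lookup w j))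
    key⇒inverts w i<j lt with key-order w i<j
    ... | inj₁ (inv , _) = inv
    ... | inj₂ (_ , lt') = ⊥-elim (ℕₚ.<-asym lt lt')

    key-injective : ∀ {n} (w : Vec Row n) → Injective _≡_ _≡_ (key w)
    key-injective w {i} {j} eq with Finₚ.<-cmp i j
    ... | tri≈ _ i≡j _ = i≡j
    ... | tri< i<j _ _ with key-order w i<j
    ...   | inj₁ (_ , lt) = ⊥-elim (ℕₚ.<⇒≢ lt (sym eq))
    ...   | inj₂ (_ , lt) = ⊥-elim (ℕₚ.<⇒≢ lt eq)
    key-injective w {i} {j} eq | tri> _ _ j<i with key-order w j<i
    ...   | inj₁ (_ , lt) = ⊥-elim (ℕₚ.<⇒≢ lt eq)
    ...   | inj₂ (_ , lt) = ⊥-elim (ℕₚ.<⇒≢ lt (sym eq))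

    perm-injective : ∀ {n} (w : Vec Row n) → Injective _≡_ _≡_ (perm w)
    perm-injective w = Ranking.rank-injective (key w) (key-injective w)

    perm-mono : ∀ {n} (w : Vec Row n) {i j} → key w i < key w j → toℕ (perm w i) < toℕ (perm w j)
    perm-mono w = Ranking.rank-mono (key w)

    perm-reflects : ∀ {n} (w : Vec Row n) {i j} → toℕ (perm w i) < toℕ (perm w j) → key w i < key w j
    perm-reflects w = Ranking.rank-reflects (key w) (key-injective w)

    perm-unique : ∀ {n} (w : Vec Row n) (π : Fin n → Fin n) → Injective _≡_ _≡_ π →
                  (∀ {i j} → key w i < key w j → toℕ (π i) < toℕ (π j)) → ∀ i → π i ≡ perm w i
    perm-unique w = Ranking.rank-unique (key w) (key-injective w)

    SameInversions : ∀ {n} → Vec Row n → Vec Row n → Set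
    SameInversions {n} w w' = ∀ {i j : Fin n} → toℕ i < toℕ j →
      inverts (lookup w i) (lookup w j) ≡ inverts (lookup w' i) (lookup w' j)

    sameInversions⇒keyOrder : ∀ {n} (w w' : Vec Row n) → SameInversions w w' →
                         ∀ {i j} → key w i < key w j → key w' i < key w' j
    sameInversions⇒keyOrder w w' same {i} {j} lt with Finₚ.<-cmp i j
    ... | tri≈ _ refl _ = ⊥-elim (ℕₚ.<-irrefl refl lt)
    ... | tri< i<j _ _ with key-order w' i<j
    ...   | inj₂ (_ , lt')  = lt'
    ...   | inj₁ (inv' , _) = ⊥-elim (ℕₚ.<-asym lt (inverts⇒key w i<j (subst T (sym (same i<j)) inv')))
    sameInversions⇒keyOrder w w' same {i} {j} lt
      | tri> _ _ j<i = inverts⇒key w' j<i (subst T (same j<i) (key⇒inverts w j<i lt))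

    sameInversions⇒perm : ∀ {n} (w w' : Vec Row n) → SameInversions w w' → ∀ i → perm w i ≡ perm w' i
    sameInversions⇒perm w w' same i =
      sym (perm-unique w (perm w') (perm-injective w') (λ lt → perm-mono w' (sameInversions⇒keyOrder w w' same lt)) i)

    perm⇒sameInversions : ∀ {n} (w w' : Vec Row n) → (∀ i → perm w i ≡ perm w' i) → SameInversions w w'
    perm⇒sameInversions w w' same {i} {j} i<j =
      T-extensional (transport w w' same) (transport w' w (λ k → sym (same k)))
      where
      transport : ∀ v v' → (∀ k → perm v k ≡ perm v' k) →
                  T (inverts (lookup v i) (lookup v j)) → T (inverts (lookup v' i) (lookup v' j))
      transport v v' same inv = key⇒inverts v' i<j (perm-reflects v'
        (subst₂ (λ a b → toℕ a < toℕ b) (same j) (same i) (perm-mono v (inverts⇒key v i<j inv))))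

  ColumnMonotone : (Row → Fin 2) → ∀ {n} → Vec Row n → Set
  ColumnMonotone column {n} w = ∀ {i j : Fin n} → toℕ i < toℕ j → column (lookup w i) Fin.≤ column (lookup w j)

module Automata where

  open Words
  open import Data.Bool using (Bool; true; false; T; if_then_else_)
  import Data.Bool.Properties as Boolₚ
  open import Data.Empty using (⊥; ⊥-elim)
  open import Data.Fin as Fin using (Fin; zero; suc; _≟_)
  import Data.Fin.Properties as Finₚ
  open import Data.List as List using (List; []; _∷_; _++_; length)
  open import Data.List.Membership.Propositional using (_∈_)
  open import Data.List.Membership.Propositional.Properties
    using (∈-map⁺; ∈-map⁻; ∈-++⁺ˡ; ∈-++⁺ʳ; ∈-++⁻; ∈-allFin)
  import Data.List.Properties as Listₚ
  open import Data.List.Relation.Unary.All as All using (All; []; _∷_)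
  open import Data.List.Relation.Unary.AllPairs using ([]; _∷_)
  open import Data.List.Relation.Unary.Any using (here; there)
  open import Data.List.Relation.Unary.Unique.Propositional using (Unique)
  import Data.List.Relation.Unary.Unique.Propositional.Properties as Uniqueₚ
  open import Data.Maybe using (Maybe; just; nothing)
  import Data.Maybe.Properties as Maybeₚ
  import Data.Maybe.Relation.Unary.All as Maybe
  open import Data.Nat as ℕ using (ℕ; zero; suc; _+_; z≤n; s≤s)
  open import Data.Nat.ListAction using (sum)
  import Data.Nat.Properties as ℕₚ
  open import Data.Product using (_×_; _,_; proj₁; proj₂)
  open import Data.Sum using (_⊎_; inj₁; inj₂)
  open import Data.Unit using (⊤; tt)
  open import Data.Vec as Vec using (Vec; []; _∷_; lookup; updateAt; replicate)
  import Data.Vec.Properties as Vecₚ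
  open import Function.Bundles using (_⇔_; mk⇔; Equivalence)
  open import Relation.Binary.Definitions using (DecidableEquality)
  open import Relation.Binary.PropositionalEquality
  open import Relation.Nullary using (¬_; Dec; yes; no)
  open import Relation.Nullary.Decidable using (True; toWitness; _→-dec_)

  Pairs : Set
  Pairs = Vec (Vec Bool 4) 4

  noPairs : Pairs
  noPairs = replicate 4 (replicate 4 false)

  hasPair : Pairs → Row → Row → Bool
  hasPair O y y' = lookup (lookup O y) y'

  mark : Row → Vec Bool 4 → Vec Bool 4
  mark x' r = updateAt r x' (λ _ → true)

  addPair : Pairs → Row → Row → Pairs
  addPair O x x' = updateAt O x (mark x')

  _≟ᴾ_ : DecidableEquality Pairs
  _≟ᴾ_ = Vecₚ.≡-dec (Vecₚ.≡-dec Boolₚ._≟_)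

  hasPair-noPairs : ∀ y y' → ¬ T (hasPair noPairs y y')
  hasPair-noPairs y y' rewrite Vecₚ.lookup-replicate y (replicate 4 false) | Vecₚ.lookup-replicate y' false = λ ()

  hasPair-addPair-self : ∀ O x x' → T (hasPair (addPair O x x') x x')
  hasPair-addPair-self O x x' rewrite Vecₚ.lookup∘updateAt x {f = mark x'} O
                                    | Vecₚ.lookup∘updateAt x' {f = λ _ → true} (lookup O x) = tt

  hasPair-addPair⁺ : ∀ O x x' {y y'} → T (hasPair O y y') → T (hasPair (addPair O x x') y y')
  hasPair-addPair⁺ O x x' {y} {y'} h with y ≟ x
  ... | no y≢x rewrite Vecₚ.lookup∘updateAt′ y x {f = mark x'} y≢x O = h
  ... | yes refl with y' ≟ x'
  ...   | yes refl = hasPair-addPair-self O y y'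
  ...   | no y'≢x' rewrite Vecₚ.lookup∘updateAt y {f = mark x'} O
                         | Vecₚ.lookup∘updateAt′ y' x' {f = λ _ → true} y'≢x' (lookup O y) = h

  hasPair-addPair⁻ : ∀ O x x' {y y'} → T (hasPair (addPair O x x') y y') → T (hasPair O y y') ⊎ (y ≡ x × y' ≡ x')
  hasPair-addPair⁻ O x x' {y} {y'} h with y ≟ x
  ... | no y≢x rewrite Vecₚ.lookup∘updateAt′ y x {f = mark x'} y≢x O = inj₁ h
  ... | yes refl with y' ≟ x'
  ...   | yes refl = inj₂ (refl , refl)
  ...   | no y'≢x' rewrite Vecₚ.lookup∘updateAt y {f = mark x'} O
                         | Vecₚ.lookup∘updateAt′ y' x' {f = λ _ → true} y'≢x' (lookup O y) = inj₁ h

  -- Reading two words in parallel, O holds the pairs of rows met so far at equal positions.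
  module Consistency (decreasing : Row → Bool) where
    open Inversions decreasing

    Compatible : Pairs → Row → Row → Set
    Compatible O x x' = ∀ y y' → T (hasPair O y y') → inverts y x ≡ inverts y' x'

    compatible? : ∀ O x x' → Dec (Compatible O x x')
    compatible? O x x' = Finₚ.all? λ y → Finₚ.all? λ y' →
      Data.Bool.T? (hasPair O y y') →-dec inverts y x Boolₚ.≟ inverts y' x'
      where import Data.Bool

    Consistent : ∀ {n} → Pairs → Vec Row n → Vec Row n → Set
    Consistent O []      []        = ⊤
    Consistent O (x ∷ w) (x' ∷ w') = Compatible O x x' × Consistent (addPair O x x') w w'

    Agree : ∀ {n} → Pairs → Vec Row n → Vec Row n → Set
    Agree O w w' = ∀ y y' → T (hasPair O y y') → ∀ j → inverts y (lookup w j) ≡ inverts y' (lookup w' j)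

    consistent⇒ : ∀ {n} O (w w' : Vec Row n) → Consistent O w w' → Agree O w w' × SameInversions w w'
    consistent⇒ O [] [] _ = (λ _ _ _ ()) , λ { {()} }
    consistent⇒ O (x ∷ w) (x' ∷ w') (compatible , consistent) = agree , same
      where
      IH = consistent⇒ (addPair O x x') w w' consistent
      agree : Agree O (x ∷ w) (x' ∷ w')
      agree y y' h zero    = compatible y y' h
      agree y y' h (suc j) = proj₁ IH y y' (hasPair-addPair⁺ O x x' h) j
      same : SameInversions (x ∷ w) (x' ∷ w')
      same {zero}  {suc j} _         = proj₁ IH x x' (hasPair-addPair-self O x x') j
      same {suc i} {suc j} (s≤s i<j) = proj₂ IH i<j

    ⇒consistent : ∀ {n} O (w w' : Vec Row n) → Agree O w w' → SameInversions w w' → Consistent O w w'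
    ⇒consistent O [] [] _ _ = tt
    ⇒consistent O (x ∷ w) (x' ∷ w') agree same =
      (λ y y' h → agree y y' h zero) , ⇒consistent (addPair O x x') w w' agree′ (λ i<j → same (s≤s i<j))
      where
      agree′ : Agree (addPair O x x') w w'
      agree′ y y' h j with hasPair-addPair⁻ O x x' h
      ... | inj₁ h′           = agree y y' h′ (suc j)
      ... | inj₂ (refl , refl) = same {zero} {suc j} (s≤s z≤n)

    consistent⇔sameInversions : ∀ {n} (w w' : Vec Row n) → Consistent noPairs w w' ⇔ SameInversions w w'
    consistent⇔sameInversions w w' = mk⇔ (λ c {i} {j} → proj₂ (consistent⇒ noPairs w w' c) {i} {j})
      (⇒consistent noPairs w w' (λ y y' h → ⊥-elim (hasPair-noPairs y y' h)))

  record DFA : Set where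
    constructor dfa
    field
      {size}    : ℕ
      step      : Fin size → Row → Maybe (Fin size)
      accepting : Fin size → Bool

  rows : List Row
  rows = List.allFin 4

  module Language (A : DFA) where
    open DFA A

    Accepts : ∀ {n} → Fin size → Vec Row n → Set
    AcceptsFrom : ∀ {n} → Maybe (Fin size) → Vec Row n → Set
    Accepts q []      = T (accepting q)
    Accepts q (x ∷ w) = AcceptsFrom (step q x) w
    AcceptsFrom nothing  w = ⊥
    AcceptsFrom (just q) w = Accepts q w

    accepted : Fin size → (n : ℕ) → List (Vec Row n)
    acceptedFrom : Maybe (Fin size) → (n : ℕ) → List (Vec Row n)
    startingWith : Fin size → (n : ℕ) → List Row → List (Vec Row (suc n))
    accepted q zero    = if accepting q then [] ∷ [] else []
    accepted q (suc n) = startingWith q n rows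
    acceptedFrom nothing  n = []
    acceptedFrom (just q) n = accepted q n
    startingWith q n []       = []
    startingWith q n (x ∷ xs) = List.map (x ∷_) (acceptedFrom (step q x) n) ++ startingWith q n xs

    accepted-sound : ∀ q n {w} → w ∈ accepted q n → Accepts q w
    acceptedFrom-sound : ∀ m n {w} → w ∈ acceptedFrom m n → AcceptsFrom m w
    startingWith-sound : ∀ q n xs {x w} → (x ∷ w) ∈ startingWith q n xs → x ∈ xs × AcceptsFrom (step q x) w
    accepted-sound q zero {[]} w∈ with accepting q
    ... | true = tt
    accepted-sound q (suc n) {x ∷ w} w∈ = proj₂ (startingWith-sound q n rows w∈)
    acceptedFrom-sound (just q) n w∈ = accepted-sound q n w∈
    startingWith-sound q n (y ∷ xs) {x} {w} x∷w∈ with ∈-++⁻ (List.map (y ∷_) (acceptedFrom (step q y) n)) x∷w∈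
    ... | inj₁ ∈head with ∈-map⁻ (y ∷_) ∈head
    ...   | w , w∈ , refl = here refl , acceptedFrom-sound (step q x) n w∈
    startingWith-sound q n (y ∷ xs) {x} {w} x∷w∈ | inj₂ ∈tail =
      Data.Product.map₁ there (startingWith-sound q n xs ∈tail)
      where import Data.Product

    accepted-complete : ∀ q {n} (w : Vec Row n) → Accepts q w → w ∈ accepted q n
    startingWith-complete : ∀ q {n} xs {x} (w : Vec Row n) → x ∈ xs → AcceptsFrom (step q x) w →
                            (x ∷ w) ∈ startingWith q n xs
    accepted-complete q [] acc with accepting q
    ... | true = here refl
    accepted-complete q (x ∷ w) acc = startingWith-complete q rows w (∈-allFin x) acc
    startingWith-complete q (x ∷ xs) w (here refl) acc with step q x
    ... | just q′ = ∈-++⁺ˡ (∈-map⁺ (x ∷_) (accepted-complete q′ w acc))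
    startingWith-complete q (y ∷ xs) w (there x∈) acc =
      ∈-++⁺ʳ (List.map (y ∷_) (acceptedFrom (step q y) _)) (startingWith-complete q xs w x∈ acc)

    accepted-unique : ∀ q n → Unique (accepted q n)
    acceptedFrom-unique : ∀ m n → Unique (acceptedFrom m n)
    startingWith-unique : ∀ q n xs → Unique xs → Unique (startingWith q n xs)
    accepted-unique q zero with accepting q
    ... | true  = [] ∷ []
    ... | false = []
    accepted-unique q (suc n) = startingWith-unique q n rows (Uniqueₚ.allFin⁺ 4)
    acceptedFrom-unique nothing  n = []
    acceptedFrom-unique (just q) n = accepted-unique q n
    startingWith-unique q n []       _            = []
    startingWith-unique q n (x ∷ xs) (x∉xs ∷ xs!) =
      Uniqueₚ.++⁺ (Uniqueₚ.map⁺ Vecₚ.∷-injectiveʳ (acceptedFrom-unique (step q x) n))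
                  (startingWith-unique q n xs xs!) disjoint
      where
      disjoint : ∀ {v} → ¬ (v ∈ List.map (x ∷_) (acceptedFrom (step q x) n) × v ∈ startingWith q n xs)
      disjoint (∈head , ∈tail) with ∈-map⁻ (x ∷_) ∈head
      ... | w , _ , refl = All.lookup x∉xs (proj₁ (startingWith-sound q n xs ∈tail)) refl

    length-startingWith : ∀ q n xs →
      length (startingWith q n xs) ≡ sum (List.map (λ x → length (acceptedFrom (step q x) n)) xs)
    length-startingWith q n []       = refl
    length-startingWith q n (x ∷ xs) = begin
      length (List.map (x ∷_) (acceptedFrom (step q x) n) ++ startingWith q n xs)
        ≡⟨ Listₚ.length-++ (List.map (x ∷_) (acceptedFrom (step q x) n)) ⟩
      length (List.map (x ∷_) (acceptedFrom (step q x) n)) + length (startingWith q n xs)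
        ≡⟨ cong₂ _+_ (Listₚ.length-map (x ∷_) (acceptedFrom (step q x) n)) (length-startingWith q n xs) ⟩
      length (acceptedFrom (step q x) n) + sum (List.map (λ x → length (acceptedFrom (step q x) n)) xs) ∎
      where open ≡-Reasoning

    length-accepted-suc : ∀ q n →
      length (accepted q (suc n)) ≡ sum (List.map (λ x → length (acceptedFrom (step q x) n)) rows)
    length-accepted-suc q n = length-startingWith q n rows

  columnDFA : (Row → Fin 2) → DFA
  columnDFA column = dfa step (λ _ → true)
    where
    step : Fin 2 → Row → Maybe (Fin 2)
    step c x with c Finₚ.≤? column x
    ... | yes _ = just (column x)
    ... | no  _ = nothing

  module _ (column : Row → Fin 2) where
    open Language (columnDFA column)

    columnDFA-accepts⇒ : ∀ {n} c (w : Vec Row n) → Accepts c w →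
                         (∀ j → c Fin.≤ column (lookup w j)) × ColumnMonotone column w
    columnDFA-accepts⇒ c [] _ = (λ ()) , λ { {()} }
    columnDFA-accepts⇒ c (x ∷ w) acc with c Finₚ.≤? column x
    ... | yes c≤x = bound , monotone
      where
      IH = columnDFA-accepts⇒ (column x) w acc
      bound : ∀ j → c Fin.≤ column (lookup (x ∷ w) j)
      bound zero    = c≤x
      bound (suc j) = ℕₚ.≤-trans c≤x (proj₁ IH j)
      monotone : ColumnMonotone column (x ∷ w)
      monotone {zero}  {suc j} _         = proj₁ IH j
      monotone {suc i} {suc j} (s≤s i<j) = proj₂ IH i<j

    columnDFA-accepts⇐ : ∀ {n} c (w : Vec Row n) →
                         (∀ j → c Fin.≤ column (lookup w j)) → ColumnMonotone column w → Accepts c w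
    columnDFA-accepts⇐ c [] _ _ = tt
    columnDFA-accepts⇐ c (x ∷ w) bound monotone with c Finₚ.≤? column x
    ... | yes _   = columnDFA-accepts⇐ (column x) w (λ j → monotone {zero} {suc j} (s≤s z≤n))
                      (λ i<j → monotone (s≤s i<j))
    ... | no c≰x = ⊥-elim (c≰x (bound zero))

    columnDFA-accepts⇔ : ∀ {n} (w : Vec Row n) → Accepts zero w ⇔ ColumnMonotone column w
    columnDFA-accepts⇔ w = mk⇔ (λ acc {i} {j} → proj₂ (columnDFA-accepts⇒ zero w acc) {i} {j})
                               (columnDFA-accepts⇐ zero w (λ _ → z≤n))

  Simulation : (A B : DFA) → (Fin (DFA.size A) → Fin (DFA.size B)) → Set
  Simulation A B f = ∀ q x → Maybe.All (λ q' → DFA.step B (f q) x ≡ just (f q')) (DFA.step A q x)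

  simulation? : ∀ A B f → Dec (Simulation A B f)
  simulation? A B f = Finₚ.all? λ q → Finₚ.all? λ x →
    Maybe.dec (λ q' → Maybeₚ.≡-dec _≟_ (DFA.step B (f q) x) (just (f q'))) (DFA.step A q x)

  simulate : ∀ A B f → Simulation A B f → (∀ q → T (DFA.accepting A q) → T (DFA.accepting B (f q))) →
             ∀ {n} q (w : Vec Row n) → Language.Accepts A q w → Language.Accepts B (f q) w
  simulate A B f f-step f-accepting q []      accepts = f-accepting q accepts
  simulate A B f f-step f-accepting q (x ∷ w) accepts with DFA.step A q x | f-step q x
  ... | just q' | Maybe.just stepped =
    subst (λ r → Language.AcceptsFrom B r w) (sym stepped) (simulate A B f f-step f-accepting q' w accepts)

  accepts⇒columnMonotone : ∀ A column colour → True (simulation? A (columnDFA column) colour) →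
                           ∀ {n} q (w : Vec Row n) → colour q ≡ zero → Language.Accepts A q w → ColumnMonotone column w
  accepts⇒columnMonotone A column colour simulated q w q-zero accepts = Equivalence.to (columnDFA-accepts⇔ column w)
    (subst (λ c → Language.Accepts (columnDFA column) c w) q-zero
      (simulate A (columnDFA column) colour (toWitness simulated) (λ _ _ → tt) q w accepts))

module Geometry where

  open Words
  open import Data.Bool using (Bool; true; false; if_then_else_)
  open import Data.Empty using (⊥-elim)
  open import Data.Fin as Fin using (Fin; zero; suc; toℕ)
  import Data.Fin.Properties as Finₚ
  import Data.Integer as ℤ
  open import Data.Nat as ℕ using (ℕ; zero; suc; s≤s; z≤n)
  import Data.Nat.Properties as ℕₚ
  open import Data.Product using (Σ; _×_; _,_; proj₁; proj₂)
  open import Data.Rational using (ℚ; 0ℚ; 1ℚ; _+_; _-_; -_; _<_; _≤_; fromℚᵘ; toℚᵘ)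
  import Data.Rational.Properties as ℚₚ
  import Data.Rational.Unnormalised as ℚᵘ
  import Data.Rational.Unnormalised.Properties as ℚᵘₚ
  open import Data.Sum using (inj₁; inj₂)
  open import Data.Unit using (tt)
  open import Data.Vec using (Vec; lookup; tabulate)
  open import Data.Vec.Properties using (lookup∘tabulate)
  open import Relation.Binary.Definitions using (tri<; tri≈; tri>)
  open import Relation.Binary.PropositionalEquality
  open import Relation.Nullary using (yes; no)
  open import Relation.Nullary.Decidable using (toWitness; _→-dec_)

  cellHeight : Bool → ℚ → ℚ
  cellHeight false t = t
  cellHeight true  t = 1ℚ - t

  ≤-+ʳ : ∀ p {q} → 0ℚ ≤ q → p ≤ p + q
  ≤-+ʳ p 0≤q = subst (_≤ p + _) (ℚₚ.+-identityʳ p) (ℚₚ.+-monoʳ-≤ p 0≤q)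

  +-cancelˡ-< : ∀ r {p q} → r + p < r + q → p < q
  +-cancelˡ-< r {p} {q} lt with p ℚₚ.<? q
  ... | yes p<q = p<q
  ... | no  p≮q = ⊥-elim (ℚₚ.<-irrefl refl (ℚₚ.<-≤-trans lt (ℚₚ.+-monoʳ-≤ r (ℚₚ.≮⇒≥ p≮q))))

  cellHeight-bounds : ∀ d {t} → 0ℚ ≤ t → t ≤ 1ℚ → 0ℚ ≤ cellHeight d t × cellHeight d t ≤ 1ℚ
  cellHeight-bounds false 0≤t t≤1 = 0≤t , t≤1
  cellHeight-bounds true {t} 0≤t t≤1 =
    subst (_≤ 1ℚ - t) (ℚₚ.+-inverseʳ t) (ℚₚ.+-monoˡ-≤ (- t) t≤1) ,
    subst (1ℚ - t ≤_) (ℚₚ.+-identityʳ 1ℚ) (ℚₚ.+-monoʳ-≤ 1ℚ (ℚₚ.neg-antimono-≤ 0≤t))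

  cellHeight-strictBounds : ∀ d {t} → 0ℚ < t → t < 1ℚ → 0ℚ < cellHeight d t × cellHeight d t < 1ℚ
  cellHeight-strictBounds false 0<t t<1 = 0<t , t<1
  cellHeight-strictBounds true {t} 0<t t<1 =
    subst (_< 1ℚ - t) (ℚₚ.+-inverseʳ t) (ℚₚ.+-monoˡ-< (- t) t<1) ,
    subst (1ℚ - t <_) (ℚₚ.+-identityʳ 1ℚ) (ℚₚ.+-monoʳ-< 1ℚ (ℚₚ.neg-antimono-< 0<t))

  cellHeight-antitone : ∀ {s t} → s < t → cellHeight true t < cellHeight true s
  cellHeight-antitone s<t = ℚₚ.+-monoʳ-< 1ℚ (ℚₚ.neg-antimono-< s<t)

  band-gap : ∀ x y → band x ℕ.< band y → ℕtoℚ (band x) + 1ℚ ≤ ℕtoℚ (band y)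
  band-gap = toWitness {a? = Finₚ.all? λ x → Finₚ.all? λ y →
    band x ℕₚ.<? band y →-dec ℕtoℚ (band x) + 1ℚ ℚₚ.≤? ℕtoℚ (band y)} tt

  -- (i + 1)/(n + 1): the second argument of mkℚᵘ is the denominator minus one.
  fraction : ℕ → ℕ → ℚ
  fraction n i = fromℚᵘ (ℚᵘ.mkℚᵘ (ℤ.+ suc i) n)

  fraction≃ : ∀ n i → ℚᵘ.mkℚᵘ (ℤ.+ suc i) n ℚᵘ.≃ toℚᵘ (fraction n i)
  fraction≃ n i = ℚᵘₚ.≃-sym (ℚₚ.toℚᵘ-fromℚᵘ _)

  fraction-mono : ∀ n {i j} → i ℕ.< j → fraction n i < fraction n j
  fraction-mono n {i} {j} i<j = ℚₚ.toℚᵘ-cancel-<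
    (ℚᵘₚ.<-respˡ-≃ (fraction≃ n i) (ℚᵘₚ.<-respʳ-≃ (fraction≃ n j)
      (ℚᵘ.*<* (ℤ.+<+ (ℕₚ.*-monoˡ-< (suc n) (s≤s i<j))))))

  fraction-pos : ∀ n i → 0ℚ < fraction n i
  fraction-pos n i = ℚₚ.toℚᵘ-cancel-< (ℚᵘₚ.<-respʳ-≃ (fraction≃ n i) (ℚᵘ.*<* (ℤ.+<+ (s≤s z≤n))))

  fraction<1 : ∀ n i → i ℕ.< n → fraction n i < 1ℚ
  fraction<1 n i i<n = ℚₚ.toℚᵘ-cancel-< (ℚᵘₚ.<-respˡ-≃ (fraction≃ n i)
    (ℚᵘ.*<* (ℤ.+<+ (subst₂ ℕ._<_ (sym (ℕₚ.*-identityʳ (suc i))) (sym (ℕₚ.+-identityʳ (suc n))) (s≤s i<n)))))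

  column-order : ∀ (c c' : Fin 2) {s t} → 0ℚ ≤ s → t ≤ 1ℚ →
                 ℕtoℚ (toℕ c) + s < ℕtoℚ (toℕ c') + t → c Fin.≤ c'
  column-order zero       c'         _   _   _  = z≤n
  column-order (suc zero) (suc zero) _   _   _  = ℕₚ.≤-refl
  column-order (suc zero) zero {s} {t} 0≤s t≤1 lt = ⊥-elim (ℚₚ.<-irrefl refl (begin-strict
    1ℚ      ≤⟨ ≤-+ʳ 1ℚ 0≤s ⟩
    1ℚ + s  <⟨ lt ⟩
    0ℚ + t  ≡⟨ ℚₚ.+-identityˡ t ⟩
    t       ≤⟨ t≤1 ⟩
    1ℚ      ∎))
    where open ℚₚ.≤-Reasoning

  column-separates : ∀ {s t} → s < 1ℚ → 0ℚ ≤ t → 0ℚ + s < 1ℚ + t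
  column-separates {s} {t} s<1 0≤t = begin-strict
    0ℚ + s  ≡⟨ ℚₚ.+-identityˡ s ⟩
    s       <⟨ s<1 ⟩
    1ℚ      ≤⟨ ≤-+ʳ 1ℚ 0≤t ⟩
    1ℚ + t  ∎
    where open ℚₚ.≤-Reasoning

  record OneCellPerRow (M : Matrix 4 2) : Set where
    field
      column     : Row → Fin 2
      decreasing : Row → Bool
      entry      : ∀ x → M x (column x) ≡ (if decreasing x then m1 else p1)
      only       : ∀ x c → M x c ≢ o → c ≡ column x

  module Gridding {M : Matrix 4 2} (shape : OneCellPerRow M) where
    open OneCellPerRow shape
    open Inversions decreasing

    point-column : (P : Point M) → Point.col P ≡ column (Point.row P)
    point-column P = only (Point.row P) (Point.col P) (Point.nonzero P)

    xcoord-point : (P : Point M) → xcoord P ≡ ℕtoℚ (toℕ (column (Point.row P))) + Point.t P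
    xcoord-point P = cong (λ c → ℕtoℚ (toℕ c) + Point.t P) (point-column P)

    ycoord-point : (P : Point M) →
                   ycoord P ≡ ℕtoℚ (band (Point.row P)) + cellHeight (decreasing (Point.row P)) (Point.t P)
    ycoord-point P = cong (ℕtoℚ (band (Point.row P)) +_) (begin
      yOffset {M = M} (M (Point.row P) (Point.col P)) (Point.t P)
        ≡⟨ cong (λ c → yOffset {M = M} (M (Point.row P) c) (Point.t P)) (point-column P) ⟩
      yOffset {M = M} (M (Point.row P) (column (Point.row P))) (Point.t P)
        ≡⟨ cong (λ e → yOffset {M = M} e (Point.t P)) (entry (Point.row P)) ⟩
      yOffset {M = M} (if decreasing (Point.row P) then m1 else p1) (Point.t P)
        ≡⟨ yOffset-cellHeight (decreasing (Point.row P)) ⟩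
      cellHeight (decreasing (Point.row P)) (Point.t P) ∎)
      where
      open ≡-Reasoning
      yOffset-cellHeight : ∀ d {t} → yOffset {M = M} (if d then m1 else p1) t ≡ cellHeight d t
      yOffset-cellHeight true  = refl
      yOffset-cellHeight false = refl

    module Heights {n} (w : Vec Row n) (t : Fin n → ℚ)
                   (t-mono : ∀ {a b} → lookup w a ≡ lookup w b → toℕ a ℕ.< toℕ b → t a < t b) where

      height : Fin n → ℚ
      height a = ℕtoℚ (band (lookup w a)) + cellHeight (decreasing (lookup w a)) (t a)

      height-sameRow : ∀ {a b} → lookup w a ≡ lookup w b →
                       offset (lookup w a) a ℕ.< offset (lookup w b) b → height a < height b
      height-sameRow {a} {b} eq lt rewrite eq with decreasing (lookup w b)
      ... | false = ℚₚ.+-monoʳ-< (ℕtoℚ (band (lookup w b))) (t-mono eq lt)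
      ... | true  = ℚₚ.+-monoʳ-< (ℕtoℚ (band (lookup w b))) (cellHeight-antitone (t-mono (sym eq) b<a))
        where
        b<a : toℕ b ℕ.< toℕ a
        b<a = ℕₚ.≰⇒> λ a≤b → ℕₚ.<⇒≱ lt (ℕₚ.∸-monoʳ-≤ n a≤b)

      band≤height : ∀ b → 0ℚ ≤ cellHeight (decreasing (lookup w b)) (t b) → ℕtoℚ (band (lookup w b)) ≤ height b
      band≤height b = ≤-+ʳ (ℕtoℚ (band (lookup w b)))

      height-mono : (∀ a → 0ℚ ≤ t a × t a ≤ 1ℚ) → ∀ {a b} → key w a ℕ.< key w b → height a ≤ height b
      height-mono bounds {a} {b} lt with key-split w lt
      ... | inj₂ (eq , lt') = ℚₚ.<⇒≤ (height-sameRow eq lt')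
      ... | inj₁ bₐ<b_b = begin
        height a                           ≤⟨ ℚₚ.+-monoʳ-≤ (ℕtoℚ (band (lookup w a))) (proj₂ (cellHeightBounds a)) ⟩
        ℕtoℚ (band (lookup w a)) + 1ℚ      ≤⟨ band-gap (lookup w a) (lookup w b) bₐ<b_b ⟩
        ℕtoℚ (band (lookup w b))           ≤⟨ band≤height b (proj₁ (cellHeightBounds b)) ⟩
        height b                           ∎
        where
        open ℚₚ.≤-Reasoning
        cellHeightBounds : ∀ c → 0ℚ ≤ cellHeight (decreasing (lookup w c)) (t c) × cellHeight (decreasing (lookup w c)) (t c) ≤ 1ℚ
        cellHeightBounds c = cellHeight-bounds (decreasing (lookup w c)) (proj₁ (bounds c)) (proj₂ (bounds c))

      height-strictMono : (∀ a → 0ℚ < t a × t a < 1ℚ) → ∀ {a b} → key w a ℕ.< key w b → height a < height b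
      height-strictMono bounds {a} {b} lt with key-split w lt
      ... | inj₂ (eq , lt') = height-sameRow eq lt'
      ... | inj₁ bₐ<b_b = begin-strict
        height a                           <⟨ ℚₚ.+-monoʳ-< (ℕtoℚ (band (lookup w a))) (proj₂ (cellHeightBounds a)) ⟩
        ℕtoℚ (band (lookup w a)) + 1ℚ      ≤⟨ band-gap (lookup w a) (lookup w b) bₐ<b_b ⟩
        ℕtoℚ (band (lookup w b))           ≤⟨ band≤height b (ℚₚ.<⇒≤ (proj₁ (cellHeightBounds b))) ⟩
        height b                           ∎
        where
        open ℚₚ.≤-Reasoning
        cellHeightBounds : ∀ c → 0ℚ < cellHeight (decreasing (lookup w c)) (t c) × cellHeight (decreasing (lookup w c)) (t c) < 1ℚ
        cellHeightBounds c = cellHeight-strictBounds (decreasing (lookup w c)) (proj₁ (bounds c)) (proj₂ (bounds c))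


    inGrid⇒perm : ∀ {n} (π : Vec (Fin n) n) → InGrid M π →
                  Σ (Vec Row n) λ w → ColumnMonotone column w × (∀ i → lookup π i ≡ perm w i)
    inGrid⇒perm {n} π (π-injective , P , x-mono , y-mono) = w , columnMonotone , π≡perm
      where
      w : Vec Row n
      w = tabulate (λ i → Point.row (P i))

      t : Fin n → ℚ
      t i = Point.t (P i)

      row-P : ∀ i → Point.row (P i) ≡ lookup w i
      row-P i = sym (lookup∘tabulate (λ i → Point.row (P i)) i)

      xcoord-P : ∀ i → xcoord (P i) ≡ ℕtoℚ (toℕ (column (lookup w i))) + t i
      xcoord-P i = trans (xcoord-point (P i)) (cong (λ x → ℕtoℚ (toℕ (column x)) + t i) (row-P i))

      x-mono′ : ∀ {i j} → toℕ i ℕ.< toℕ j →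
                ℕtoℚ (toℕ (column (lookup w i))) + t i < ℕtoℚ (toℕ (column (lookup w j))) + t j
      x-mono′ {i} {j} i<j = subst₂ _<_ (xcoord-P i) (xcoord-P j) (x-mono i j i<j)

      t-mono : ∀ {a b} → lookup w a ≡ lookup w b → toℕ a ℕ.< toℕ b → t a < t b
      t-mono {a} {b} eq a<b = +-cancelˡ-< (ℕtoℚ (toℕ (column (lookup w a))))
        (subst (λ x → _ < ℕtoℚ (toℕ (column x)) + t b) (sym eq) (x-mono′ a<b))

      columnMonotone : ColumnMonotone column w
      columnMonotone {i} {j} i<j =
        column-order _ _ (Point.t≥0 (P i)) (Point.t≤1 (P j)) (x-mono′ i<j)

      open Heights w t t-mono

      ycoord-P : ∀ i → ycoord (P i) ≡ height i
      ycoord-P i = trans (ycoord-point (P i))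
        (cong (λ x → ℕtoℚ (band x) + cellHeight (decreasing x) (t i)) (row-P i))

      -- Heights follow the key only weakly, as points may share a corner, but π orders them strictly.
      π-mono : ∀ {a b} → key w a ℕ.< key w b → toℕ (lookup π a) ℕ.< toℕ (lookup π b)
      π-mono {a} {b} lt with ℕₚ.<-cmp (toℕ (lookup π a)) (toℕ (lookup π b))
      ... | tri< πₐ<π_b _ _ = πₐ<π_b
      ... | tri≈ _ πₐ≡π_b _ =
        ⊥-elim (ℕₚ.<-irrefl (cong (key w) (π-injective (Finₚ.toℕ-injective πₐ≡π_b))) lt)
      ... | tri> _ _ π_b<πₐ = ⊥-elim (ℚₚ.<-irrefl refl (ℚₚ.<-≤-trans
              (subst₂ _<_ (ycoord-P b) (ycoord-P a) (y-mono b a π_b<πₐ))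
              (height-mono (λ c → Point.t≥0 (P c) , Point.t≤1 (P c)) lt)))

      π≡perm : ∀ i → lookup π i ≡ perm w i
      π≡perm = perm-unique w (lookup π) π-injective π-mono

    perm⇒inGrid : ∀ {n} (w : Vec Row n) → ColumnMonotone column w → InGrid M (tabulate (perm w))
    perm⇒inGrid {n} w columnMonotone = π-injective , P , x-mono , y-mono
      where
      π : Vec (Fin n) n
      π = tabulate (perm w)

      π≡perm : ∀ i → lookup π i ≡ perm w i
      π≡perm = lookup∘tabulate (perm w)

      π-injective : IsPerm π
      π-injective {i} {j} eq = perm-injective w (trans (sym (π≡perm i)) (trans eq (π≡perm j)))

      t : Fin n → ℚ
      t i = fraction n (toℕ i)

      t∈⟨0,1⟩ : ∀ i → 0ℚ < t i × t i < 1ℚ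
      t∈⟨0,1⟩ i = fraction-pos n (toℕ i) , fraction<1 n (toℕ i) (Finₚ.toℕ<n i)

      cell-nonzero : ∀ x → M x (column x) ≢ o
      cell-nonzero x eq = signed≢o (decreasing x) (trans (sym (entry x)) eq)
        where
        signed≢o : ∀ d → (if d then m1 else p1) ≢ o
        signed≢o true  ()
        signed≢o false ()

      P : Fin n → Point M
      P i = pt (lookup w i) (column (lookup w i)) (cell-nonzero (lookup w i)) (t i)
               (ℚₚ.<⇒≤ (proj₁ (t∈⟨0,1⟩ i))) (ℚₚ.<⇒≤ (proj₂ (t∈⟨0,1⟩ i)))

      x-mono : ∀ i j → i Fin.< j → xcoord (P i) < xcoord (P j)
      x-mono i j i<j with column (lookup w i) | column (lookup w j) | columnMonotone i<j
      ... | zero     | zero     | _ = ℚₚ.+-monoʳ-< 0ℚ (fraction-mono n i<j)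
      ... | suc zero | suc zero | _ = ℚₚ.+-monoʳ-< 1ℚ (fraction-mono n i<j)
      ... | zero     | suc zero | _ = column-separates (proj₂ (t∈⟨0,1⟩ i)) (ℚₚ.<⇒≤ (proj₁ (t∈⟨0,1⟩ j)))
      ... | suc zero | zero     | ()

      open Heights w t (λ _ → fraction-mono n)

      y-mono : ∀ i j → lookup π i Fin.< lookup π j → ycoord (P i) < ycoord (P j)
      y-mono i j lt = subst₂ _<_ (sym (ycoord-point (P i))) (sym (ycoord-point (P j)))
        (height-strictMono t∈⟨0,1⟩
          (perm-reflects w (subst₂ (λ a b → toℕ a ℕ.< toℕ b) (π≡perm i) (π≡perm j) lt)))

module Certificates where

  open Words
  open Automata
  open import Data.Bool using (Bool; true; T; _∧_; if_then_else_)
  import Data.Bool as Bool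
  open import Data.Bool.ListAction using (any; all)
  import Data.Bool.Properties as Boolₚ
  open import Data.Empty using (⊥; ⊥-elim)
  open import Data.Fin as Fin using (Fin; zero; suc; _≟_)
  import Data.Fin.Properties as Finₚ
  open import Data.List as List using (List; []; _∷_; _++_; concatMap)
  open import Data.List.Membership.Propositional using (_∈_; find)
  open import Data.List.Membership.Propositional.Properties using (∈-concatMap⁻; ∈-deduplicate⁻)
  import Data.List.Properties as Listₚ
  open import Data.List.Relation.Unary.All as All using (All; []; _∷_; all?)
  open import Data.List.Relation.Unary.Any as Any using (Any; here; any?)
  open import Data.Maybe using (Maybe; just; nothing; maybe′)
  import Data.Maybe.Relation.Unary.All as Maybe
  open import Data.Nat using (ℕ; zero; suc)
  open import Data.Product using (∃-syntax; _×_; _,_; proj₁; proj₂)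
  import Data.Product.Properties as Productₚ
  open import Data.Unit using (tt)
  open import Data.Vec using (Vec; []; _∷_)
  open import Function using (_∘_)
  open import Function.Bundles using (Equivalence)
  open import Relation.Binary.Definitions using (DecidableEquality)
  open import Relation.Binary.PropositionalEquality
  open import Relation.Nullary using (Dec; yes; no; does)
  open import Relation.Nullary.Decidable using (True; toWitness; _×-dec_; _→-dec_; map′)

  -- Untrusted breadth-first search for certificates: whatever it returns is checked afterwards.
  explore : ∀ {X : Set} → (X → X → Bool) → (X → List X) → ℕ → List X → List X → List X
  explore similar next zero       visited frontier       = visited
  explore similar next (suc fuel) visited []             = visited
  explore similar next (suc fuel) visited (x ∷ frontier) =
    if any (similar x) visited
    then explore similar next fuel visited frontier
    else explore similar next fuel (x ∷ visited) (frontier ++ next x)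

  image : ∀ {X Y : Set} → (X → Row → Maybe Y) → List X → List Y
  image f = concatMap (λ a → concatMap (λ b → maybe′ (_∷ []) [] (f a b)) rows)

  ∈-image⁻ : ∀ {X Y : Set} (f : X → Row → Maybe Y) xs {y} →
             y ∈ image f xs → ∃[ a ] a ∈ xs × ∃[ b ] f a b ≡ just y
  ∈-image⁻ f xs y∈ with find (∈-concatMap⁻ (λ a → concatMap (λ b → maybe′ (_∷ []) [] (f a b)) rows) y∈)
  ... | a , a∈xs , y∈fa with find (∈-concatMap⁻ (λ b → maybe′ (_∷ []) [] (f a b)) {xs = rows} y∈fa)
  ...   | b , _ , y∈fab = a , a∈xs , b , ∈-maybe (f a b) y∈fab
    where
    ∈-maybe : ∀ {y} m → y ∈ maybe′ (_∷ []) [] m → m ≡ just y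
    ∈-maybe (just y) (here refl) = refl

  module Certified (decreasing : Row → Bool) (column : Row → Fin 2) (A : DFA) where
    open DFA A
    open Inversions decreasing
    open Consistency decreasing using (Compatible; Consistent; consistent⇔sameInversions)
    open Language A
    private module Columns = Language (columnDFA column)

    columnStep : Fin 2 → Row → Maybe (Fin 2)
    columnStep = DFA.step (columnDFA column)

    Target : Set
    Target = Pairs × Fin size

    _≟ᵀ_ : DecidableEquality Target
    _≟ᵀ_ = Productₚ.≡-dec _≟ᴾ_ _≟_

    -- Abstracting over the decision procedure (instantiated at the end) keeps the type checker from unfolding it.
    -- advance and pairStep branch on its Boolean answer only, so that evaluation never builds compatibility proofs.
    module Decide (compatible? : ∀ O x x' → Dec (Compatible O x x')) where

      advanceIf : Bool → Pairs → Row → Row → Maybe (Fin size) → Maybe Target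
      advanceIf true O x x' (just q') = just (addPair O x x' , q')
      advanceIf _    _ _ _  _         = nothing

      advance : Target → Row → Row → Maybe Target
      advance (O , q) x x' = advanceIf (does (compatible? O x x')) O x x' (step q x')

      advanceIf-sound : ∀ {O x x' p'} (c? : Dec (Compatible O x x')) m → advanceIf (does c?) O x x' m ≡ just p' →
                        Compatible O x x' × m ≡ just (proj₂ p') × proj₁ p' ≡ addPair O x x'
      advanceIf-sound (yes compatible) (just q') refl = compatible , refl , refl

      post : List Target → Row → List Target
      post E x = List.deduplicate _≟ᵀ_ (image (λ p → advance p x) E)

      post-sound : ∀ {E x O' q'} → (O' , q') ∈ post E x →
                   ∃[ O ] ∃[ q ] (O , q) ∈ E × ∃[ x' ] Compatible O x x' × step q x' ≡ just q' × O' ≡ addPair O x x'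
      post-sound {E} {x} p'∈
        with ∈-image⁻ (λ p → advance p x) E (∈-deduplicate⁻ _≟ᵀ_ (image (λ p → advance p x) E) p'∈)
      ... | (O , q) , p∈E , x' , advanced with advanceIf-sound (compatible? O x x') (step q x') advanced
      ...   | compatible , stepped , refl = O , q , p∈E , x' , compatible , stepped , refl

      -- In a state (c, E), c is the column reached so far; each (O, q) ∈ E describes a candidate partner word:
      -- O holds the pairs of rows met so far, and q is the state of A it has reached.
      record NormState : Set where
        constructor normState
        field
          lastColumn : Fin 2
          targets    : List Target
      open NormState

      Normalises : NormState → Set
      Normalises m = ∀ {n} (w : Vec Row n) → Columns.Accepts (lastColumn m) w →
        ∃[ p ] p ∈ targets m × ∃[ w' ] Accepts (proj₂ p) w' × Consistent (proj₁ p) w w'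

      Successor : List NormState → Fin 2 → List Target → Set
      Successor S c E = Any (λ m → lastColumn m ≡ c × All (_∈ E) (targets m)) S

      NormClosed : List NormState → Set
      NormClosed S = All (λ m → Any (T ∘ accepting ∘ proj₂) (targets m) ×
        (∀ x → Maybe.All (λ c → Successor S c (post (targets m) x)) (columnStep (lastColumn m) x))) S

      normClosed? : ∀ S → Dec (NormClosed S)
      normClosed? S = all? (λ m → any? (Bool.T? ∘ accepting ∘ proj₂) (targets m) ×-dec
        Finₚ.all? λ x → Maybe.dec (λ c → successor? c (post (targets m) x)) (columnStep (lastColumn m) x)) S
        where
        open import Data.List.Membership.DecPropositional _≟ᵀ_ using (_∈?_)
        successor? : ∀ c E → Dec (Successor S c E)
        successor? c E = any? (λ m → lastColumn m Finₚ.≟ c ×-dec all? (_∈? E) (targets m)) S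

      normClosed⇒normalises : ∀ {S} → NormClosed S → ∀ {m} → m ∈ S → Normalises m
      normClosed⇒normalises closed m∈S [] accepts with find (proj₁ (All.lookup closed m∈S))
      ... | p , p∈ , accepting-p = p , p∈ , [] , accepting-p , tt
      normClosed⇒normalises {S} closed {m} m∈S (x ∷ w) accepts
        with columnStep (lastColumn m) x | proj₂ (All.lookup closed m∈S) x
      ... | just c | Maybe.just successor with find successor
      ...   | m' , m'∈S , refl , m'⊆post with normClosed⇒normalises closed m'∈S w accepts
      ...     | (O' , q') , p'∈ , w' , accepts' , consistent' with post-sound {targets m} {x} (All.lookup m'⊆post p'∈)
      ...       | O , q , p∈ , x' , compatible , stepped , refl =
        (O , q) , p∈ , x' ∷ w' , subst (λ r → AcceptsFrom r w') (sym stepped) accepts' , compatible , consistent'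

      normNext : NormState → List NormState
      normNext m =
        concatMap (λ x → maybe′ (λ c → normState c (post (targets m) x) ∷ []) [] (columnStep (lastColumn m) x)) rows

      sameNormState : NormState → NormState → Bool
      sameNormState m m' =
        does (lastColumn m Finₚ.≟ lastColumn m') ∧ (targets m ⊆ᵇ targets m') ∧ (targets m' ⊆ᵇ targets m)
        where
        open import Data.List.Membership.DecPropositional _≟ᵀ_ using (_∈?_)
        _⊆ᵇ_ : List Target → List Target → Bool
        E ⊆ᵇ E' = all (λ p → does (p ∈? E')) E

      -- Two words read in parallel from the states left and right; equal records whether they have agreed so far.
      record PairState : Set where
        constructor pairState
        field
          pairs       : Pairs
          left right  : Fin size
          equal       : Bool
      open PairState

      _≟ˢ_ : DecidableEquality PairState
      pairState O q r e ≟ˢ pairState O' q' r' e' =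
        map′ (λ { (refl , refl , refl , refl) → refl }) (λ { refl → refl , refl , refl , refl })
             (O ≟ᴾ O' ×-dec q ≟ q' ×-dec r ≟ r' ×-dec e Boolₚ.≟ e')

      pairStepIf : Bool → PairState → Row → Row → Maybe (Fin size) → Maybe (Fin size) → Maybe PairState
      pairStepIf true (pairState O q r e) x x' (just q') (just r') =
        just (pairState (addPair O x x') q' r' (e ∧ does (x ≟ x')))
      pairStepIf _    _                   _ _  _         _         = nothing

      pairStep : PairState → Row → Row → Maybe PairState
      pairStep s@(pairState O q r e) x x' = pairStepIf (does (compatible? O x x')) s x x' (step q x) (step r x')

      pairStepIf-complete : ∀ {O q r e x x'} (c? : Dec (Compatible O x x')) q' r' → Compatible O x x' →
        pairStepIf (does c?) (pairState O q r e) x x' (just q') (just r') ≡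
        just (pairState (addPair O x x') q' r' (e ∧ does (x ≟ x')))
      pairStepIf-complete (yes _)           q' r' _          = refl
      pairStepIf-complete (no incompatible) q' r' compatible = ⊥-elim (incompatible compatible)

      pairStep-complete : ∀ O q r e {x x' q' r'} → Compatible O x x' → step q x ≡ just q' → step r x' ≡ just r' →
                          pairStep (pairState O q r e) x x' ≡ just (pairState (addPair O x x') q' r' (e ∧ does (x ≟ x')))
      pairStep-complete O q r e {x} {x'} {q'} {r'} compatible stepped stepped' =
        trans (cong₂ (pairStepIf (does (compatible? O x x')) (pairState O q r e) x x') stepped stepped')
              (pairStepIf-complete (compatible? O x x') q' r' compatible)

      PairClosed : List PairState → Set
      PairClosed S = All (λ s → (T (accepting (left s)) → T (accepting (right s)) → T (equal s)) ×
                                (∀ x x' → Maybe.All (_∈ S) (pairStep s x x'))) S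

      pairClosed? : ∀ S → Dec (PairClosed S)
      pairClosed? S = all? (λ s →
        (Bool.T? (accepting (left s)) →-dec Bool.T? (accepting (right s)) →-dec Bool.T? (equal s))
        ×-dec Finₚ.all? λ x → Finₚ.all? λ x' → Maybe.dec (_∈? S) (pairStep s x x')) S
        where open import Data.List.Membership.DecPropositional _≟ˢ_ using (_∈?_)

      pairClosed⇒equal : ∀ {S} → PairClosed S → ∀ {s} → s ∈ S → ∀ {n} (w w' : Vec Row n) →
                         Accepts (left s) w → Accepts (right s) w' → Consistent (pairs s) w w' → T (equal s) × w ≡ w'
      pairClosed⇒equal closed s∈S [] [] accepts accepts' _ = proj₁ (All.lookup closed s∈S) accepts accepts' , refl
      pairClosed⇒equal {S} closed {pairState O q r e} s∈S (x ∷ w) (x' ∷ w') accepts accepts' (compatible , consistent)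
        with step q x in stepped | step r x' in stepped'
      ... | just q' | just r' with proj₂ (All.lookup closed s∈S) x x'
      ...   | successor rewrite pairStep-complete O q r e compatible stepped stepped' with successor
      ...     | Maybe.just s'∈S with pairClosed⇒equal closed s'∈S w w' accepts accepts' consistent
      ...       | equal' , refl with e | x ≟ x'
      ...         | true | yes refl = tt , refl

      pairNext : PairState → List PairState
      pairNext s = image (pairStep s) rows

      _≟ᴺ_ : DecidableEquality NormState
      normState c E ≟ᴺ normState c' E' =
        map′ (λ { (refl , refl) → refl }) (λ { refl → refl , refl }) (c ≟ c' ×-dec Listₚ.≡-dec _≟ᵀ_ E E')

      module _ (q₀ : Fin size) where

        initialNormState : NormState
        initialNormState = normState zero ((noPairs , q₀) ∷ [])

        initialPairState : PairState
        initialPairState = pairState noPairs q₀ q₀ true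

        normStates : List NormState
        normStates = explore sameNormState normNext 1000 [] (initialNormState ∷ [])

        pairStates : List PairState
        pairStates = explore (λ s t → does (s ≟ˢ t)) pairNext 1000 [] (initialPairState ∷ [])

        normCertificate? : Dec (initialNormState ∈ normStates × NormClosed normStates)
        normCertificate? = Any.any? (initialNormState ≟ᴺ_) normStates ×-dec normClosed? normStates

        pairCertificate? : Dec (initialPairState ∈ pairStates × PairClosed pairStates)
        pairCertificate? = Any.any? (initialPairState ≟ˢ_) pairStates ×-dec pairClosed? pairStates

        normalise-closed : ∀ {S} → initialNormState ∈ S × NormClosed S →
                           ∀ {n} (w : Vec Row n) → ColumnMonotone column w → ∃[ w' ] Accepts q₀ w' × SameInversions w w'
        normalise-closed (initial∈S , closed) w monotone
          with normClosed⇒normalises closed initial∈S w (Equivalence.from (columnDFA-accepts⇔ column w) monotone)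
        ... | _ , here refl , w' , accepts , consistent =
          w' , accepts , Equivalence.to (consistent⇔sameInversions w w') consistent

        accepted-injective-closed : ∀ {S} → initialPairState ∈ S × PairClosed S →
                                    ∀ {n} (w w' : Vec Row n) → Accepts q₀ w → Accepts q₀ w' → SameInversions w w' → w ≡ w'
        accepted-injective-closed (initial∈S , closed) w w' accepts accepts' same =
          proj₂ (pairClosed⇒equal closed initial∈S w w' accepts accepts'
                   (Equivalence.from (consistent⇔sameInversions w w') same))

        normalise : True normCertificate? →
                    ∀ {n} (w : Vec Row n) → ColumnMonotone column w → ∃[ w' ] Accepts q₀ w' × SameInversions w w'
        normalise certified = normalise-closed (toWitness certified)

        accepted-injective : True pairCertificate? →
                             ∀ {n} (w w' : Vec Row n) → Accepts q₀ w → Accepts q₀ w' → SameInversions w w' → w ≡ w'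
        accepted-injective certified = accepted-injective-closed (toWitness certified)

    open Decide (Consistency.compatible? decreasing) public

module Enumeration where

  open Words
  open Automata
  open Geometry
  open import Data.Fin using (Fin)
  open import Data.List as List using (List; []; _∷_; length)
  open import Data.List.Membership.Propositional using (_∈_)
  open import Data.List.Membership.Propositional.Properties using (∈-map⁺; ∈-map⁻)
  import Data.List.Properties as Listₚ
  open import Data.List.Relation.Unary.All as All using (All; []; _∷_)
  import Data.List.Relation.Unary.All.Properties as Allₚ
  open import Data.List.Relation.Unary.AllPairs using ([]; _∷_)
  open import Data.List.Relation.Unary.Unique.Propositional using (Unique)
  open import Data.Product using (∃-syntax; _×_; _,_)
  open import Data.Vec using (Vec; lookup; tabulate)
  open import Data.Vec.Properties using (lookup∘tabulate; tabulate∘lookup; tabulate-cong)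
  open import Function.Bundles using (mk⇔)
  open import Relation.Binary.PropositionalEquality

  unique-map : ∀ {A B : Set} (f : A → B) {P : A → Set} {xs} → All P xs →
               (∀ {a b} → P a → P b → f a ≡ f b → a ≡ b) → Unique xs → Unique (List.map f xs)
  unique-map f []       injective []            = []
  unique-map f (pₐ ∷ ps) injective (a∉xs ∷ xs!) =
    Allₚ.map⁺ (All.zipWith (λ (a≢b , p_b) fa≡fb → a≢b (injective pₐ p_b fa≡fb)) (a∉xs , ps)) ∷
    unique-map f ps injective xs!

  module Enumerate {M : Matrix 4 2} (shape : OneCellPerRow M) (A : DFA) (q₀ : Fin (DFA.size A)) where
    open OneCellPerRow shape
    open Inversions decreasing
    open Language A
    open Gridding shape

    module _ (monotone : ∀ {n} (w : Vec Row n) → Accepts q₀ w → ColumnMonotone column w)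
             (normalise : ∀ {n} (w : Vec Row n) → ColumnMonotone column w → ∃[ w' ] Accepts q₀ w' × SameInversions w w')
             (injective : ∀ {n} (w w' : Vec Row n) → Accepts q₀ w → Accepts q₀ w' → SameInversions w w' → w ≡ w')
             where

      gridCount : ∀ n → HasCard {n} (InGrid M) (length (accepted q₀ n))
      gridCount n = List.map permutation (accepted q₀ n) , unique , Listₚ.length-map permutation (accepted q₀ n) ,
                    λ π → mk⇔ (listed π) (gridded π)
        where
        permutation : Vec Row n → Vec (Fin n) n
        permutation w = tabulate (perm w)

        permutation-injective : ∀ {w w'} → Accepts q₀ w → Accepts q₀ w' → permutation w ≡ permutation w' → w ≡ w'
        permutation-injective {w} {w'} accepts accepts' eq = injective w w' accepts accepts' (perm⇒sameInversions w w' λ i →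
          trans (sym (lookup∘tabulate (perm w) i)) (trans (cong (λ π → lookup π i) eq) (lookup∘tabulate (perm w') i)))

        unique : Unique (List.map permutation (accepted q₀ n))
        unique = unique-map permutation (All.tabulate (accepted-sound q₀ n)) permutation-injective (accepted-unique q₀ n)

        listed : ∀ π → InGrid M π → π ∈ List.map permutation (accepted q₀ n)
        listed π gridded with inGrid⇒perm π gridded
        ... | w , monotone-w , π≡perm with normalise w monotone-w
        ...   | w' , accepts , same = subst (_∈ List.map permutation (accepted q₀ n)) (sym π≡permutation)
                                        (∈-map⁺ permutation (accepted-complete q₀ w' accepts))
          where
          π≡permutation : π ≡ permutation w'
          π≡permutation = trans (sym (tabulate∘lookup π))
                                (tabulate-cong (λ i → trans (π≡perm i) (sameInversions⇒perm w w' same i)))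

        gridded : ∀ π → π ∈ List.map permutation (accepted q₀ n) → InGrid M π
        gridded π π∈ with ∈-map⁻ permutation π∈
        ... | w , w∈ , refl = perm⇒inGrid w (monotone w (accepted-sound q₀ n w∈))

module Instances where

  open Words
  open Automata
  open Certificates
  open Geometry
  open Enumeration
  open import Data.Bool using (Bool; true; false; if_then_else_)
  open import Data.Empty using (⊥-elim)
  open import Data.Fin using (Fin; zero; suc; #_)
  open import Data.List using (length)
  open import Data.Maybe using (Maybe; just; nothing)
  open import Data.Vec using (Vec; []; _∷_; lookup)
  open import Relation.Binary.PropositionalEquality

  tableDFA : ∀ {k} → Vec (Vec (Maybe (Fin k)) 4) k → Vec Bool k → DFA
  tableDFA table accepting = dfa (λ q x → lookup (lookup table q) x) (lookup accepting)

  columnJ : Row → Fin 2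
  columnJ = lookup (# 1 ∷ # 0 ∷ # 0 ∷ # 1 ∷ [])

  shapeJ : OneCellPerRow MJ
  shapeJ = record { column = columnJ ; decreasing = λ _ → false ; entry = entry ; only = only }
    where
    entry : ∀ x → MJ x (columnJ x) ≡ p1
    entry zero                   = refl
    entry (suc zero)             = refl
    entry (suc (suc zero))       = refl
    entry (suc (suc (suc zero))) = refl
    only : ∀ x c → MJ x c ≢ o → c ≡ columnJ x
    only zero                   (suc zero) _       = refl
    only (suc zero)             zero       _       = refl
    only (suc (suc zero))       zero       _       = refl
    only (suc (suc (suc zero))) (suc zero) _       = refl
    only zero                   zero       nonzero = ⊥-elim (nonzero refl)
    only (suc zero)             (suc zero) nonzero = ⊥-elim (nonzero refl)
    only (suc (suc zero))       (suc zero) nonzero = ⊥-elim (nonzero refl)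
    only (suc (suc (suc zero))) zero       nonzero = ⊥-elim (nonzero refl)

  -- Accepts 1ᵏ, and u v with u ∈ {1,2}* containing the factor 12 and v empty or in 3{0,3}*.
  canonicalJ : DFA
  canonicalJ = tableDFA
    ((nothing   ∷ just (# 1) ∷ just (# 2) ∷ nothing   ∷ []) ∷
     (nothing   ∷ just (# 1) ∷ just (# 3) ∷ nothing   ∷ []) ∷
     (nothing   ∷ just (# 4) ∷ just (# 2) ∷ nothing   ∷ []) ∷
     (nothing   ∷ just (# 3) ∷ just (# 3) ∷ just (# 5) ∷ []) ∷
     (nothing   ∷ just (# 4) ∷ just (# 3) ∷ nothing   ∷ []) ∷
     (just (# 5) ∷ nothing   ∷ nothing   ∷ just (# 5) ∷ []) ∷ [])
    (true ∷ true ∷ false ∷ true ∷ false ∷ true ∷ [])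

  gridCountJ : ∀ n → HasCard {n} (InGrid MJ) (length (Language.accepted canonicalJ (# 0) n))
  gridCountJ = gridCount
    (λ w → accepts⇒columnMonotone canonicalJ columnJ colour _ (# 0) w refl)
    (normalise (# 0) _) (accepted-injective (# 0) _)
    where
    colour : Fin 6 → Fin 2
    colour = lookup (# 0 ∷ # 0 ∷ # 0 ∷ # 0 ∷ # 0 ∷ # 1 ∷ [])
    open Enumerate shapeJ canonicalJ (# 0)
    open Certified (λ _ → false) columnJ canonicalJ

  columnK : Row → Fin 2
  columnK = lookup (# 0 ∷ # 1 ∷ # 0 ∷ # 1 ∷ [])

  decreasingK : Row → Bool
  decreasingK = lookup (false ∷ false ∷ true ∷ true ∷ [])

  shapeK : OneCellPerRow MK
  shapeK = record { column = columnK ; decreasing = decreasingK ; entry = entry ; only = only }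
    where
    entry : ∀ x → MK x (columnK x) ≡ (if decreasingK x then m1 else p1)
    entry zero                   = refl
    entry (suc zero)             = refl
    entry (suc (suc zero))       = refl
    entry (suc (suc (suc zero))) = refl
    only : ∀ x c → MK x c ≢ o → c ≡ columnK x
    only zero                   zero       _       = refl
    only (suc zero)             (suc zero) _       = refl
    only (suc (suc zero))       zero       _       = refl
    only (suc (suc (suc zero))) (suc zero) _       = refl
    only zero                   (suc zero) nonzero = ⊥-elim (nonzero refl)
    only (suc zero)             zero       nonzero = ⊥-elim (nonzero refl)
    only (suc (suc zero))       (suc zero) nonzero = ⊥-elim (nonzero refl)
    only (suc (suc (suc zero))) zero       nonzero = ⊥-elim (nonzero refl)

  -- Accepts 2ᵏ, and u 1 v with u ∈ {0,2}* containing a 2 and v ∈ {1,3}*.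
  canonicalK : DFA
  canonicalK = tableDFA
    ((just (# 1) ∷ nothing   ∷ just (# 2) ∷ nothing   ∷ []) ∷
     (just (# 1) ∷ nothing   ∷ just (# 3) ∷ nothing   ∷ []) ∷
     (just (# 3) ∷ just (# 4) ∷ just (# 2) ∷ nothing   ∷ []) ∷
     (just (# 3) ∷ just (# 4) ∷ just (# 3) ∷ nothing   ∷ []) ∷
     (nothing   ∷ just (# 4) ∷ nothing   ∷ just (# 4) ∷ []) ∷ [])
    (true ∷ false ∷ true ∷ false ∷ true ∷ [])

  gridCountK : ∀ n → HasCard {n} (InGrid MK) (length (Language.accepted canonicalK (# 0) n))
  gridCountK = gridCount
    (λ w → accepts⇒columnMonotone canonicalK columnK colour _ (# 0) w refl)
    (normalise (# 0) _) (accepted-injective (# 0) _)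
    where
    colour : Fin 5 → Fin 2
    colour = lookup (# 0 ∷ # 0 ∷ # 0 ∷ # 0 ∷ # 1 ∷ [])
    open Enumerate shapeK canonicalK (# 0)
    open Certified decreasingK columnK canonicalK

module Counts where

  open Automata
  open Instances
  open import Data.Fin using (Fin; #_)
  open import Data.List using (length)
  open import Data.Nat using (ℕ; zero; suc; _+_; _*_; _^_)
  import Data.Nat.Properties as ℕₚ
  open import Data.Nat.Tactic.RingSolver using (solve-∀)
  open import Relation.Binary.PropositionalEquality

  open ≡-Reasoning

  module CountJ where
    open Language canonicalJ

    N : Fin 6 → ℕ → ℕ
    N q n = length (accepted q n)

    N₅ : ∀ n → N (# 5) n ≡ 2 ^ n
    N₅ zero    = refl
    N₅ (suc n) = begin
      N (# 5) (suc n)             ≡⟨ length-accepted-suc (# 5) n ⟩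
      N (# 5) n + (N (# 5) n + 0) ≡⟨ cong (λ a → a + (a + 0)) (N₅ n) ⟩
      2 ^ n + (2 ^ n + 0)         ≡⟨ lemma (2 ^ n) ⟩
      2 * 2 ^ n                   ∎
      where
      lemma : ∀ p → p + (p + 0) ≡ 2 * p
      lemma = solve-∀

    2N₃ : ∀ n → 2 * N (# 3) n ≡ (n + 2) * 2 ^ n
    2N₃ zero    = refl
    2N₃ (suc n) = begin
      2 * N (# 3) (suc n)                             ≡⟨ cong (2 *_) (length-accepted-suc (# 3) n) ⟩
      2 * (N (# 3) n + (N (# 3) n + (N (# 5) n + 0))) ≡⟨ lemma₁ (N (# 3) n) (N (# 5) n) ⟩
      2 * (2 * N (# 3) n) + 2 * N (# 5) n             ≡⟨ cong₂ (λ a b → 2 * a + 2 * b) (2N₃ n) (N₅ n) ⟩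
      2 * ((n + 2) * 2 ^ n) + 2 * 2 ^ n               ≡⟨ lemma₂ n (2 ^ n) ⟩
      (suc n + 2) * (2 * 2 ^ n)                       ∎
      where
      lemma₁ : ∀ a b → 2 * (a + (a + (b + 0))) ≡ 2 * (2 * a) + 2 * b
      lemma₁ = solve-∀
      lemma₂ : ∀ n p → 2 * ((n + 2) * p) + 2 * p ≡ (suc n + 2) * (2 * p)
      lemma₂ = solve-∀

    2N₄ : ∀ n → 2 * N (# 4) n ≡ n * 2 ^ n
    2N₄ zero    = refl
    2N₄ (suc n) = begin
      2 * N (# 4) (suc n)                 ≡⟨ cong (2 *_) (length-accepted-suc (# 4) n) ⟩
      2 * (N (# 4) n + (N (# 3) n + 0))   ≡⟨ lemma₁ (N (# 4) n) (N (# 3) n) ⟩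
      2 * N (# 4) n + 2 * N (# 3) n       ≡⟨ cong₂ _+_ (2N₄ n) (2N₃ n) ⟩
      n * 2 ^ n + (n + 2) * 2 ^ n         ≡⟨ lemma₂ n (2 ^ n) ⟩
      suc n * (2 * 2 ^ n)                 ∎
      where
      lemma₁ : ∀ a b → 2 * (a + (b + 0)) ≡ 2 * a + 2 * b
      lemma₁ = solve-∀
      lemma₂ : ∀ n p → n * p + (n + 2) * p ≡ suc n * (2 * p)
      lemma₂ = solve-∀

    N₁ : ∀ n → N (# 1) n ≡ 1 + N (# 4) n
    N₁ zero    = refl
    N₁ (suc n) = begin
      N (# 1) (suc n)                 ≡⟨ length-accepted-suc (# 1) n ⟩
      N (# 1) n + (N (# 3) n + 0)     ≡⟨ cong (_+ (N (# 3) n + 0)) (N₁ n) ⟩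
      1 + N (# 4) n + (N (# 3) n + 0) ≡⟨ ℕₚ.+-assoc 1 (N (# 4) n) (N (# 3) n + 0) ⟩
      1 + (N (# 4) n + (N (# 3) n + 0)) ≡⟨ cong (1 +_) (length-accepted-suc (# 4) n) ⟨
      1 + N (# 4) (suc n)             ∎

    2N₂ : ∀ n → 2 * N (# 2) n + 2 * 2 ^ n ≡ n * 2 ^ n + 2
    2N₂ zero    = refl
    2N₂ (suc n) = begin
      2 * N (# 2) (suc n) + 2 * (2 * 2 ^ n)
        ≡⟨ cong (λ a → 2 * a + 2 * (2 * 2 ^ n)) (length-accepted-suc (# 2) n) ⟩
      2 * (N (# 4) n + (N (# 2) n + 0)) + 2 * (2 * 2 ^ n) ≡⟨ lemma₁ (N (# 4) n) (N (# 2) n) (2 ^ n) ⟩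
      2 * N (# 4) n + (2 * N (# 2) n + 2 * 2 ^ n) + 2 * 2 ^ n ≡⟨ cong₂ (λ a b → a + b + 2 * 2 ^ n) (2N₄ n) (2N₂ n) ⟩
      n * 2 ^ n + (n * 2 ^ n + 2) + 2 * 2 ^ n             ≡⟨ lemma₂ n (2 ^ n) ⟩
      suc n * (2 * 2 ^ n) + 2                             ∎
      where
      lemma₁ : ∀ a b p → 2 * (a + (b + 0)) + 2 * (2 * p) ≡ 2 * a + (2 * b + 2 * p) + 2 * p
      lemma₁ = solve-∀
      lemma₂ : ∀ n p → n * p + (n * p + 2) + 2 * p ≡ suc n * (2 * p) + 2
      lemma₂ = solve-∀

    N₀ : ∀ m → N (# 0) (suc m) + 2 ^ m ≡ m * 2 ^ m + 2
    N₀ m = ℕₚ.*-cancelˡ-≡ (N (# 0) (suc m) + 2 ^ m) (m * 2 ^ m + 2) 2 (begin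
      2 * (N (# 0) (suc m) + 2 ^ m)                 ≡⟨ cong (λ a → 2 * (a + 2 ^ m)) (length-accepted-suc (# 0) m) ⟩
      2 * (N (# 1) m + (N (# 2) m + 0) + 2 ^ m)     ≡⟨ lemma₁ (N (# 1) m) (N (# 2) m) (2 ^ m) ⟩
      2 * N (# 1) m + (2 * N (# 2) m + 2 * 2 ^ m)   ≡⟨ cong₂ (λ a b → 2 * a + b) (N₁ m) (2N₂ m) ⟩
      2 * (1 + N (# 4) m) + (m * 2 ^ m + 2)         ≡⟨ lemma₂ (N (# 4) m) (m * 2 ^ m) ⟩
      2 * N (# 4) m + (m * 2 ^ m + 4)               ≡⟨ cong (_+ (m * 2 ^ m + 4)) (2N₄ m) ⟩
      m * 2 ^ m + (m * 2 ^ m + 4)                   ≡⟨ lemma₃ (m * 2 ^ m) ⟩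
      2 * (m * 2 ^ m + 2)                           ∎)
      where
      lemma₁ : ∀ a b p → 2 * (a + (b + 0) + p) ≡ 2 * a + (2 * b + 2 * p)
      lemma₁ = solve-∀
      lemma₂ : ∀ a q → 2 * (1 + a) + (q + 2) ≡ 2 * a + (q + 4)
      lemma₂ = solve-∀
      lemma₃ : ∀ q → q + (q + 4) ≡ 2 * (q + 2)
      lemma₃ = solve-∀

  module CountK where
    open Language canonicalK

    N : Fin 5 → ℕ → ℕ
    N q n = length (accepted q n)

    N₄ : ∀ n → N (# 4) n ≡ 2 ^ n
    N₄ zero    = refl
    N₄ (suc n) = begin
      N (# 4) (suc n)             ≡⟨ length-accepted-suc (# 4) n ⟩
      N (# 4) n + (N (# 4) n + 0) ≡⟨ cong (λ a → a + (a + 0)) (N₄ n) ⟩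
      2 ^ n + (2 ^ n + 0)         ≡⟨ lemma (2 ^ n) ⟩
      2 * 2 ^ n                   ∎
      where
      lemma : ∀ p → p + (p + 0) ≡ 2 * p
      lemma = solve-∀

    2N₃ : ∀ n → 2 * N (# 3) n ≡ n * 2 ^ n
    2N₃ zero    = refl
    2N₃ (suc n) = begin
      2 * N (# 3) (suc n)                             ≡⟨ cong (2 *_) (length-accepted-suc (# 3) n) ⟩
      2 * (N (# 3) n + (N (# 4) n + (N (# 3) n + 0))) ≡⟨ lemma₁ (N (# 3) n) (N (# 4) n) ⟩
      2 * (2 * N (# 3) n) + 2 * N (# 4) n             ≡⟨ cong₂ (λ a b → 2 * a + 2 * b) (2N₃ n) (N₄ n) ⟩
      2 * (n * 2 ^ n) + 2 * 2 ^ n                     ≡⟨ lemma₂ n (2 ^ n) ⟩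
      suc n * (2 * 2 ^ n)                             ∎
      where
      lemma₁ : ∀ a b → 2 * (a + (b + (a + 0))) ≡ 2 * (2 * a) + 2 * b
      lemma₁ = solve-∀
      lemma₂ : ∀ n p → 2 * (n * p) + 2 * p ≡ suc n * (2 * p)
      lemma₂ = solve-∀

    2N₁ : ∀ n → 2 * N (# 1) n + 2 * 2 ^ n ≡ n * 2 ^ n + 2
    2N₁ zero    = refl
    2N₁ (suc n) = begin
      2 * N (# 1) (suc n) + 2 * (2 * 2 ^ n)
        ≡⟨ cong (λ a → 2 * a + 2 * (2 * 2 ^ n)) (length-accepted-suc (# 1) n) ⟩
      2 * (N (# 1) n + (N (# 3) n + 0)) + 2 * (2 * 2 ^ n) ≡⟨ lemma₁ (N (# 1) n) (N (# 3) n) (2 ^ n) ⟩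
      2 * N (# 3) n + (2 * N (# 1) n + 2 * 2 ^ n) + 2 * 2 ^ n ≡⟨ cong₂ (λ a b → a + b + 2 * 2 ^ n) (2N₃ n) (2N₁ n) ⟩
      n * 2 ^ n + (n * 2 ^ n + 2) + 2 * 2 ^ n             ≡⟨ lemma₂ n (2 ^ n) ⟩
      suc n * (2 * 2 ^ n) + 2                             ∎
      where
      lemma₁ : ∀ a b p → 2 * (a + (b + 0)) + 2 * (2 * p) ≡ 2 * b + (2 * a + 2 * p) + 2 * p
      lemma₁ = solve-∀
      lemma₂ : ∀ n p → n * p + (n * p + 2) + 2 * p ≡ suc n * (2 * p) + 2
      lemma₂ = solve-∀

    2N₂ : ∀ n → 2 * N (# 2) n ≡ n * 2 ^ n + 2
    2N₂ zero    = refl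
    2N₂ (suc n) = begin
      2 * N (# 2) (suc n)                             ≡⟨ cong (2 *_) (length-accepted-suc (# 2) n) ⟩
      2 * (N (# 3) n + (N (# 4) n + (N (# 2) n + 0))) ≡⟨ lemma₁ (N (# 3) n) (N (# 4) n) (N (# 2) n) ⟩
      2 * N (# 3) n + 2 * N (# 4) n + 2 * N (# 2) n   ≡⟨ cong₂ _+_ (cong₂ (λ a b → a + 2 * b) (2N₃ n) (N₄ n)) (2N₂ n) ⟩
      n * 2 ^ n + 2 * 2 ^ n + (n * 2 ^ n + 2)         ≡⟨ lemma₂ n (2 ^ n) ⟩
      suc n * (2 * 2 ^ n) + 2                         ∎
      where
      lemma₁ : ∀ a b c → 2 * (a + (b + (c + 0))) ≡ 2 * a + 2 * b + 2 * c
      lemma₁ = solve-∀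
      lemma₂ : ∀ n p → n * p + 2 * p + (n * p + 2) ≡ suc n * (2 * p) + 2
      lemma₂ = solve-∀

    N₀ : ∀ m → N (# 0) (suc m) + 2 ^ m ≡ m * 2 ^ m + 2
    N₀ m = ℕₚ.*-cancelˡ-≡ (N (# 0) (suc m) + 2 ^ m) (m * 2 ^ m + 2) 2 (begin
      2 * (N (# 0) (suc m) + 2 ^ m)                 ≡⟨ cong (λ a → 2 * (a + 2 ^ m)) (length-accepted-suc (# 0) m) ⟩
      2 * (N (# 1) m + (N (# 2) m + 0) + 2 ^ m)     ≡⟨ lemma₁ (N (# 1) m) (N (# 2) m) (2 ^ m) ⟩
      (2 * N (# 1) m + 2 * 2 ^ m) + 2 * N (# 2) m   ≡⟨ cong₂ _+_ (2N₁ m) (2N₂ m) ⟩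
      (m * 2 ^ m + 2) + (m * 2 ^ m + 2)             ≡⟨ lemma₂ (m * 2 ^ m) ⟩
      2 * (m * 2 ^ m + 2)                           ∎)
      where
      lemma₁ : ∀ a b p → 2 * (a + (b + 0) + p) ≡ (2 * a + 2 * p) + 2 * b
      lemma₁ = solve-∀
      lemma₂ : ∀ q → (q + 2) + (q + 2) ≡ 2 * (q + 2)
      lemma₂ = solve-∀

open Instances
open Counts
open import Data.Fin using (#_)
open import Data.Integer using (+_; _-_; _*_; _+_)
import Data.Integer.Properties as ℤₚ
open import Data.Integer.Tactic.RingSolver using (solve-∀)
open import Data.Nat as ℕ using (ℕ; suc; _≤_; _∸_; _^_)
import Data.Nat.Properties as ℕₚ
open import Data.Product using (Σ; _×_; _,_)
open import Relation.Binary.PropositionalEquality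

closedForm : ∀ m k → k ℕ.+ 2 ^ m ≡ m ℕ.* 2 ^ m ℕ.+ 2 → + k ≡ (+ suc m - + 2) * + (2 ^ m) + + 2
closedForm m k eq = begin
  + k                                 ≡⟨ lemma₁ (+ k) (+ p) ⟩
  + k + + p - + p                     ≡⟨ cong (_- + p) (trans (sym (ℤₚ.pos-+ k p)) (cong +_ eq)) ⟩
  + (m ℕ.* p ℕ.+ 2) - + p             ≡⟨ cong (_- + p) (trans (ℤₚ.pos-+ (m ℕ.* p) 2) (cong (_+ + 2) (ℤₚ.pos-* m p))) ⟩
  + m * + p + + 2 - + p               ≡⟨ lemma₂ (+ m) (+ p) ⟩
  (+ 1 + + m - + 2) * + p + + 2       ≡⟨ cong (λ z → (z - + 2) * + p + + 2) (ℤₚ.pos-+ 1 m) ⟨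
  (+ suc m - + 2) * + p + + 2         ∎
  where
  open ≡-Reasoning
  p : ℕ
  p = 2 ^ m
  lemma₁ : ∀ a b → a ≡ a + b - b
  lemma₁ = solve-∀
  lemma₂ : ∀ a b → a * b + + 2 - b ≡ (+ 1 + a - + 2) * b + + 2
  lemma₂ = solve-∀

proposition8p6 : (n : ℕ) → 1 ≤ n →
    Σ ℕ λ k → (+ k ≡ (+ n - + 2) * + (2 ^ (n ∸ 1)) + + 2)
    × HasCard {n} (InGrid MJ) k × HasCard {n} (InGrid MK) k
proposition8p6 (suc m) _ =
  CountJ.N (# 0) (suc m) , closedForm m _ (CountJ.N₀ m) , gridCountJ (suc m) ,
  subst (HasCard (InGrid MK)) sameCount (gridCountK (suc m))
  where
  sameCount : CountK.N (# 0) (suc m) ≡ CountJ.N (# 0) (suc m)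
  sameCount = ℕₚ.+-cancelʳ-≡ (2 ^ m) _ _ (trans (CountK.N₀ m) (sym (CountJ.N₀ m)))
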